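{- Let $T$ be a caterpillar whose body is the path $v_1,\ldots,v_r$ ($r\ge1$), and for $i=1,\ldots,r$ let $l_i$ be the number of leaves of $T$ adjacent to $v_i$. Then the number of cycles of multiplicity $1$ arising as products of the edge-transpositions of $T$ is $2\prod_{i=1}^r l_i!$ if $r>1$, and $l_1!$ if $r=1$.
   Context: A caterpillar is a tree such that removing all leaves gives a path, called its body. Each edge $\{i,j\}$ is regarded as the transposition $(i,j)$; the multiplicity of a cycle is the number of orderings of the edges (each edge exactly once) whose product equals it. -}

module Defs where

open import Data.Nat using (ℕ; zero; suc; _*_)
open import Data.Nat using (_!)
open import Data.Fin using (Fin; zero; suc; _≟_; inject₁)
open import Data.Fin.Permutation.Components using (transpose)
open import Data.Product using (_×_; _,_; proj₁; proj₂; ∃)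
import Data.Product.Properties as PP
open import Data.Sum using (_⊎_; inj₁; inj₂)
open import Data.Empty using (⊥)
open import Data.List using (List; []; _∷_; map; concatMap; filter; length; allFin)
open import Data.Nat.ListAction using (product)
open import Data.List.Membership.Propositional using (_∈_)
open import Data.Vec using (Vec; tabulate)
import Data.Vec.Properties as VP
open import Function using (id; _∘_)
open import Relation.Binary.PropositionalEquality using (_≡_)
open import Relation.Nullary using (¬_)
open import Relation.Nullary.Decidable using (_⊎-dec_; _×-dec_)
import Data.Nat as N

-- A graph on the vertex set Fin n, given by its list of edges;
-- an edge (a , b) stands for the unordered pair {a , b}.
Edges : ℕ → Set
Edges n = List (Fin n × Fin n)

_≟e_ : ∀ {n} (e f : Fin n × Fin n) → Relation.Nullary.Dec (e ≡ f)
_≟e_ = PP.≡-dec _≟_ _≟_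

Adj : ∀ {n} → Edges n → Fin n → Fin n → Set
Adj E a b = ((a , b) ∈ E) ⊎ ((b , a) ∈ E)

adj? : ∀ {n} (E : Edges n) a b → Relation.Nullary.Dec (Adj E a b)
adj? E a b = ((a , b) ∈? E) ⊎-dec ((b , a) ∈? E)
  where open import Data.List.Membership.DecPropositional _≟e_ using (_∈?_)

data Reach {n} (E : Edges n) : Fin n → Fin n → Set where
  here : ∀ {a} → Reach E a a
  step : ∀ {a b c} → Adj E a b → Reach E b c → Reach E a c

Connected : ∀ {n} → Edges n → Set
Connected {n} E = (a b : Fin n) → Reach E a b

IsTree : ∀ {n} → Edges n → Set
IsTree {n} E = Connected E × (suc (length E) ≡ n)

deg : ∀ {n} → Edges n → Fin n → ℕ
deg E u = length (filter (λ e → (proj₁ e ≟ u) ⊎-dec (proj₂ e ≟ u)) E)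

IsLeaf : ∀ {n} → Edges n → Fin n → Set
IsLeaf E u = deg E u ≡ 1

-- T is a caterpillar whose body is the path v 0 , v 1 , … , v k
-- (so r = k + 1 ≥ 1): T is a tree, the v i are distinct, consecutive
-- ones are adjacent, and the vertices that remain after deleting all
-- leaves are exactly the v i.
record IsCaterpillarWithBody {n k} (E : Edges n) (v : Fin (suc k) → Fin n) : Set where
  field
    tree      : IsTree E
    injective : ∀ i j → v i ≡ v j → i ≡ j
    path      : ∀ (i : Fin k) → Adj E (v (inject₁ i)) (v (suc i))
    body      : ∀ u → (¬ IsLeaf E u) → ∃ λ i → v i ≡ u
    bodyNoLeaf : ∀ i → ¬ IsLeaf E (v i)

leavesAt : ∀ {n} → Edges n → Fin n → ℕ
leavesAt {n} E w =
  length (filter (λ u → (deg E u N.≟ 1) ×-dec adj? E u w) (allFin n))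

insertAll : ∀ {A : Set} → A → List A → List (List A)
insertAll x []       = (x ∷ []) ∷ []
insertAll x (y ∷ ys) = (x ∷ y ∷ ys) ∷ map (y ∷_) (insertAll x ys)

orderings : ∀ {A : Set} → List A → List (List A)
orderings []       = [] ∷ []
orderings (x ∷ xs) = concatMap (insertAll x) (orderings xs)

prodFun : ∀ {n} → Edges n → Fin n → Fin n
prodFun []             = id
prodFun ((a , b) ∷ es) = transpose a b ∘ prodFun es

-- permutations (more generally maps) of Fin n, represented by their
-- table of values, so that equality is decidable
Perm : ℕ → Set
Perm n = Vec (Fin n) n

prodPerm : ∀ {n} → Edges n → Perm n
prodPerm es = tabulate (prodFun es)

multiplicity : ∀ {n} → Edges n → Perm n → ℕ
multiplicity E σ = length (filter (λ w → VP.≡-dec _≟_ (prodPerm w) σ) (orderings E))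

allVecs : ∀ {n} k → List (Vec (Fin n) k)
allVecs zero    = Vec.[] ∷ []
allVecs {n} (suc k) = concatMap (λ x → map (x Vec.∷_) (allVecs k)) (allFin n)

numMultOne : ∀ {n} → Edges n → ℕ
numMultOne {n} E = length (filter (λ σ → multiplicity E σ N.≟ 1) (allVecs n))

prodFact : ∀ {r} → (Fin r → ℕ) → ℕ
prodFact {r} l = product (map (λ i → l i !) (allFin r))

module Submission where

open import Defs
open import Data.Nat using (ℕ; zero; suc; _*_; _≥_)
open import Data.Nat using (_!)
open import Data.Fin using (Fin; zero; fromℕ)
open import Data.Fin.Properties using (toℕ-fromℕ)
open import Data.Product using (_×_; _,_)
open import Relation.Binary.PropositionalEquality using (_≡_; refl; cong)

-- Swapping two adjacent edges without a common vertex does not change the product, so an ordering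
-- of multiplicity 1 is a chain: consecutive edges share a vertex. Conversely, two orderings with the
-- same product order every two edges at a common vertex alike: deleting pendant edges one at a time
-- acts on both products by the same splice and reduces them to the products of that pair alone,
-- whose two orders differ. So the cycles of multiplicity 1 are counted by the chains. In a
-- caterpillar rank the leaf edges at v j by 2 j and the body edge from v i to v (i + 1) by 2 i + 1;
-- a chain runs through the ranks monotonically, up or down, with the leaf edges at each body vertex
-- in any order. That gives 2 ∏ l_i ! chains when the body has an edge, and l_1 ! otherwise.

module ListFacts where

  open import Data.Nat using (ℕ; suc; _+_; _*_; _≤_; _<_; z≤n; s≤s)
  import Data.Nat.Properties as ℕₚ
  import Data.Fin.Properties as Fₚ
  open import Data.Fin using (Fin; zero; suc; toℕ)
  open import Data.List using (List; []; _∷_; [_]; _++_; map; concatMap; filter; filterᵇ; length; reverse; lookup)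
  open import Data.List.Properties
    using (length-++; ∷-injective; ++-assoc; reverse-++; unfold-reverse; filter-++; filter-none; filter-accept; filter-reject; filter-≐; filter-some)
  open import Data.List.Membership.Propositional using (_∈_; _∉_; lose)
  open import Data.List.Membership.Propositional.Properties
    using (∈-map⁻; ∈-∃++; ∈-lookup; ∈-concat⁻′; ∈-concat⁺′; ∈-map⁺; ∈-++⁺ˡ; ∈-++⁺ʳ; ∈-++⁻)
  open import Data.List.Membership.Propositional.Properties.WithK using (unique∧set⇒bag; unique⇒irrelevant)
  open import Data.List.Relation.Unary.Any using (here; there; index)
  open import Data.List.Relation.Unary.Any.Properties using (lookup-index)
  open import Data.List.Relation.Unary.All using (All; []; _∷_)
  import Data.List.Relation.Unary.All as All
  open import Data.List.Relation.Unary.AllPairs using (AllPairs; []; _∷_)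
  open import Data.List.Relation.Unary.Unique.Propositional using (Unique)
  import Data.List.Relation.Unary.Unique.Propositional.Properties as Unique
  open import Data.List.Relation.Binary.Permutation.Propositional using (_↭_; ↭-sym; ↭⇒↭ₛ)
  import Data.List.Relation.Binary.Permutation.Propositional.Properties as ↭
  open import Data.List.Relation.Binary.Permutation.Setoid.Properties using (Unique-resp-↭)
  open import Data.List.Relation.Binary.BagAndSetEquality using (∼bag⇒↭)
  open import Data.Product using (_×_; _,_; proj₁; proj₂; ∃)
  open import Data.Sum using (_⊎_; inj₁; inj₂; [_,_]′)
  import Data.Sum as Sum
  open import Data.List.Extrema.Nat using (argmin; argmax; argmin-sel; argmax-sel; f[argmin]≤f[⊤]; f[argmin]≤f[xs]; f[⊥]≤f[argmax]; f[xs]≤f[argmax])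
  open import Data.Empty using (⊥; ⊥-elim)
  open import Function using (_∘_)
  open import Function.Bundles using (mk⇔)
  open import Relation.Binary.PropositionalEquality
    using (_≡_; _≢_; refl; sym; trans; cong; cong₂; subst; subst₂; setoid; module ≡-Reasoning)
  open import Relation.Binary.Definitions using (DecidableEquality)
  open import Relation.Nullary using (¬_; yes; no; does)
  open import Data.Bool using (true; false)
  open import Relation.Nullary.Decidable using (_⊎-dec_)
  open import Relation.Unary using (Decidable; ∁)

  module _ {A : Set} where

    ∈-concatMap⁺′ : ∀ {B : Set} (f : A → List B) {xs : List A} {x z} →
      x ∈ xs → z ∈ f x → z ∈ concatMap f xs
    ∈-concatMap⁺′ f x∈ z∈ = ∈-concat⁺′ z∈ (∈-map⁺ f x∈)

    ∈-concatMap⁻′ : ∀ {B : Set} (f : A → List B) (xs : List A) {z} →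
      z ∈ concatMap f xs → ∃ λ x → x ∈ xs × z ∈ f x
    ∈-concatMap⁻′ f xs z∈ with ∈-concat⁻′ (map f xs) z∈
    ... | ys , z∈ys , ys∈ with ∈-map⁻ f ys∈
    ... | x , x∈ , refl = x , x∈ , z∈ys

    length-concatMap-const : ∀ {B : Set} (f : A → List B) (c : ℕ) (xs : List A) →
      (∀ {x} → x ∈ xs → length (f x) ≡ c) → length (concatMap f xs) ≡ length xs * c
    length-concatMap-const f c [] _ = refl
    length-concatMap-const f c (x ∷ xs) h =
      trans (length-++ (f x)) (cong₂ _+_ (h (here refl)) (length-concatMap-const f c xs (h ∘ there)))

    unique-resp-↭ : ∀ {xs ys : List A} → Unique xs → xs ↭ ys → Unique ys
    unique-resp-↭ u p = Unique-resp-↭ (setoid A) (↭⇒↭ₛ p) u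

    unique-concatMap : ∀ {B : Set} (f : A → List B) (xs : List A) → Unique xs →
      (∀ {x} → x ∈ xs → Unique (f x)) →
      (∀ {x y z} → x ∈ xs → y ∈ xs → z ∈ f x → z ∈ f y → x ≡ y) →
      Unique (concatMap f xs)
    unique-concatMap f [] _ _ _ = []
    unique-concatMap f (x ∷ xs) (x∉ ∷ u) uf dis =
      Unique.++⁺ (uf (here refl)) (unique-concatMap f xs u (uf ∘ there) (λ a b → dis (there a) (there b)))
        (λ (z∈fx , z∈rest) → disjoint z∈fx z∈rest)
      where
      disjoint : ∀ {z} → z ∈ f x → z ∈ concatMap f xs → ⊥
      disjoint z∈fx z∈rest with ∈-concatMap⁻′ f xs z∈rest
      ... | y , y∈ , z∈fy = All.lookup x∉ y∈ (dis (here refl) (there y∈) z∈fx z∈fy)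

    unique-map-injectiveOn : ∀ {B : Set} (f : A → B) (xs : List A) → Unique xs →
      (∀ {a b} → a ∈ xs → b ∈ xs → f a ≡ f b → a ≡ b) → Unique (map f xs)
    unique-map-injectiveOn f [] _ _ = []
    unique-map-injectiveOn f (x ∷ xs) (x∉ ∷ u) inj =
      All.tabulate fresh ∷ unique-map-injectiveOn f xs u (λ a b → inj (there a) (there b))
      where
      fresh : ∀ {y} → y ∈ map f xs → f x ≢ y
      fresh y∈ eq with ∈-map⁻ f y∈
      ... | a , a∈ , refl = All.lookup x∉ a∈ (inj (here refl) (there a∈) eq)

    unique-∉-split : ∀ (p : List A) {x q} → Unique (p ++ x ∷ q) → x ∉ p × x ∉ q
    unique-∉-split [] (x∉q ∷ _) = (λ ()) , (λ x∈ → All.lookup x∉q x∈ refl)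
    unique-∉-split (y ∷ p) (y∉ ∷ u) =
      (λ { (here refl) → All.lookup y∉ (∈-++⁺ʳ p (here refl)) refl ; (there i) → proj₁ (unique-∉-split p u) i })
      , proj₂ (unique-∉-split p u)

    unique-++⁻ˡ : ∀ (p : List A) {q} → Unique (p ++ q) → Unique p
    unique-++⁻ˡ [] _ = []
    unique-++⁻ˡ (x ∷ p) (x∉ ∷ u) = All.tabulate (λ y∈ → All.lookup x∉ (∈-++⁺ˡ y∈)) ∷ unique-++⁻ˡ p u

    unique-++⁻ʳ : ∀ (p : List A) {q} → Unique (p ++ q) → Unique q
    unique-++⁻ʳ [] u = u
    unique-++⁻ʳ (x ∷ p) (_ ∷ u) = unique-++⁻ʳ p u

    split-injective : ∀ {x : A} (p q p′ q′ : List A) → p ++ x ∷ q ≡ p′ ++ x ∷ q′ →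
      x ∉ p → x ∉ p′ → p ≡ p′ × q ≡ q′
    split-injective [] q [] q′ eq _ _ = refl , proj₂ (∷-injective eq)
    split-injective [] q (y ∷ p′) q′ eq _ x∉p′ = ⊥-elim (x∉p′ (here (proj₁ (∷-injective eq))))
    split-injective (y ∷ p) q [] q′ eq x∉p _ = ⊥-elim (x∉p (here (sym (proj₁ (∷-injective eq)))))
    split-injective (y ∷ p) q (y′ ∷ p′) q′ eq x∉p x∉p′ with ∷-injective eq
    ... | refl , eq′ with split-injective p q p′ q′ eq′ (x∉p ∘ there) (x∉p′ ∘ there)
    ... | refl , refl = refl , refl

    unique-sameElements⇒↭ : ∀ {xs ys : List A} → Unique xs → Unique ys →
      (∀ {z} → z ∈ xs → z ∈ ys) → (∀ {z} → z ∈ ys → z ∈ xs) → xs ↭ ys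
    unique-sameElements⇒↭ ux uy f g = ∼bag⇒↭ (unique∧set⇒bag ux uy (mk⇔ f g))

    unique-sameElements⇒length≡ : ∀ {xs ys : List A} → Unique xs → Unique ys →
      (∀ {z} → z ∈ xs → z ∈ ys) → (∀ {z} → z ∈ ys → z ∈ xs) → length xs ≡ length ys
    unique-sameElements⇒length≡ ux uy f g = ↭.↭-length (unique-sameElements⇒↭ ux uy f g)

    length≡1⇒≡ : ∀ {xs : List A} {a b} → length xs ≡ 1 → a ∈ xs → b ∈ xs → a ≡ b
    length≡1⇒≡ {xs = c ∷ []} _ (here refl) (here refl) = refl

    length≡1⇒∈ : ∀ {xs : List A} → length xs ≡ 1 → ∃ λ a → a ∈ xs
    length≡1⇒∈ {xs = c ∷ []} _ = c , here refl

    unique-constant⇒length≡1 : ∀ (xs : List A) {w} → Unique xs → w ∈ xs →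
      (∀ {x} → x ∈ xs → x ≡ w) → length xs ≡ 1
    unique-constant⇒length≡1 (c ∷ []) _ _ _ = refl
    unique-constant⇒length≡1 (c ∷ d ∷ xs) (c∉ ∷ _) _ all≡ =
      ⊥-elim (All.lookup c∉ (here refl) (trans (all≡ (here refl)) (sym (all≡ (there (here refl))))))

    locate : ∀ {w p q : List A} {a x} → w ≡ p ++ a ∷ q → x ∈ w → x ∈ p ⊎ x ≡ a ⊎ x ∈ q
    locate {p = p} refl x∈ with ∈-++⁻ p x∈
    ... | inj₁ x∈p = inj₁ x∈p
    ... | inj₂ (here x≡a) = inj₂ (inj₁ x≡a)
    ... | inj₂ (there x∈q) = inj₂ (inj₂ x∈q)

    allPairs-split⁺ : ∀ {R : A → A → Set} (w : List A) →
      (∀ p a q → w ≡ p ++ a ∷ q → All (R a) q) → AllPairs R w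
    allPairs-split⁺ [] _ = []
    allPairs-split⁺ (x ∷ w) h = h [] x w refl ∷ allPairs-split⁺ w (λ p a q eq → h (x ∷ p) a q (cong (x ∷_) eq))

    allPairs-split⁻ : ∀ {R : A → A → Set} (p : List A) {a q} → AllPairs R (p ++ a ∷ q) →
      All (λ x → R x a) p × All (R a) q
    allPairs-split⁻ [] (a<q ∷ _) = [] , a<q
    allPairs-split⁻ (x ∷ p) {a} (x<rest ∷ rest) =
      (All.lookup x<rest (∈-++⁺ʳ p (here refl)) ∷ proj₁ (allPairs-split⁻ p rest)) , proj₂ (allPairs-split⁻ p rest)

    ∈-reverse : ∀ {x} (xs : List A) → x ∈ xs → x ∈ reverse xs
    ∈-reverse xs = ↭.∈-resp-↭ (↭-sym (↭.↭-reverse xs))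

    all-reverse : ∀ {P : A → Set} (xs : List A) → All P xs → All P (reverse xs)
    all-reverse xs ps = All.tabulate (All.lookup ps ∘ ↭.∈-resp-↭ (↭.↭-reverse xs))

    reverse-split : ∀ (p q : List A) a → reverse (p ++ a ∷ q) ≡ reverse q ++ a ∷ reverse p
    reverse-split p q a =
      trans (reverse-++ p (a ∷ q)) (trans (cong (_++ reverse p) (unfold-reverse a q)) (++-assoc (reverse q) [ a ] (reverse p)))

    reverse-split₂ : ∀ (p q : List A) a b → reverse (p ++ a ∷ b ∷ q) ≡ reverse q ++ b ∷ a ∷ reverse p
    reverse-split₂ p q a b =
      trans (reverse-split p (b ∷ q) a)
        (trans (cong (_++ a ∷ reverse p) (unfold-reverse b q)) (++-assoc (reverse q) [ b ] (a ∷ reverse p)))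

    allPairs-both-ways : ∀ {R : A → A → Set} (w : List A) → AllPairs R w → AllPairs R (reverse w) →
      ∀ {a b} → a ∈ w → b ∈ w → a ≢ b → R a b × R b a
    allPairs-both-ways {R} w fwd bwd {a} {b} a∈ b∈ a≢b with ∈-∃++ a∈
    ... | p , q , refl with ∈-++⁻ p b∈
    ... | inj₂ (here b≡a) = ⊥-elim (a≢b (sym b≡a))
    ... | inj₂ (there b∈q) =
      All.lookup (proj₂ (allPairs-split⁻ p fwd)) b∈q ,
      All.lookup (proj₁ (allPairs-split⁻ (reverse q) (subst (AllPairs R) (reverse-split p q a) bwd))) (∈-reverse q b∈q)
    ... | inj₁ b∈p =
      All.lookup (proj₂ (allPairs-split⁻ (reverse q) (subst (AllPairs R) (reverse-split p q a) bwd))) (∈-reverse p b∈p) ,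
      All.lookup (proj₁ (allPairs-split⁻ p fwd)) b∈p

    predecessor : ∀ (a : A) r {x} → x ∈ r → ∃ λ p → ∃ λ y → ∃ λ q → a ∷ r ≡ p ++ y ∷ x ∷ q
    predecessor a (b ∷ r) (here refl) = [] , a , r , refl
    predecessor a (b ∷ r) (there x∈r) with predecessor b r x∈r
    ... | p , y , q , eq = a ∷ p , y , q , cong (a ∷_) eq

    filter-exactly-two : ∀ {P : A → Set} (P? : Decidable P) p a q b r → P a → P b →
      All (∁ P) p → All (∁ P) q → All (∁ P) r → filter P? (p ++ a ∷ q ++ b ∷ r) ≡ a ∷ b ∷ []
    filter-exactly-two P? p a q b r Pa Pb ¬Pp ¬Pq ¬Pr = begin
      filter P? (p ++ a ∷ q ++ b ∷ r)                  ≡⟨ filter-++ P? p (a ∷ q ++ b ∷ r) ⟩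
      filter P? p ++ filter P? (a ∷ q ++ b ∷ r)        ≡⟨ cong (_++ _) (filter-none P? ¬Pp) ⟩
      filter P? (a ∷ q ++ b ∷ r)                       ≡⟨ filter-accept P? Pa ⟩
      a ∷ filter P? (q ++ b ∷ r)                       ≡⟨ cong (a ∷_) (filter-++ P? q (b ∷ r)) ⟩
      a ∷ filter P? q ++ filter P? (b ∷ r)             ≡⟨ cong (λ l → a ∷ l ++ _) (filter-none P? ¬Pq) ⟩
      a ∷ filter P? (b ∷ r)                            ≡⟨ cong (a ∷_) (filter-accept P? Pb) ⟩
      a ∷ b ∷ filter P? r                              ≡⟨ cong (λ l → a ∷ b ∷ l) (filter-none P? ¬Pr) ⟩
      a ∷ b ∷ []                                       ∎
      where open ≡-Reasoning

  module _ {A : Set} (_≟_ : DecidableEquality A) where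

    oneOf? : (a b : A) → Decidable (λ x → x ≡ a ⊎ x ≡ b)
    oneOf? a b x = (x ≟ a) ⊎-dec (x ≟ b)

    oneOf-comm : ∀ {a b} (xs : List A) → filter (oneOf? a b) xs ≡ filter (oneOf? b a) xs
    oneOf-comm = filter-≐ (oneOf? _ _) (oneOf? _ _) (Sum.swap , Sum.swap)

    unique⇒filter-oneOf : ∀ p a q b r → Unique (p ++ a ∷ q ++ b ∷ r) →
      filter (oneOf? a b) (p ++ a ∷ q ++ b ∷ r) ≡ a ∷ b ∷ []
    unique⇒filter-oneOf p a q b r u =
      filter-exactly-two (oneOf? a b) p a q b r (inj₁ refl) (inj₂ refl)
        (neither a∉p b∉p) (neither (a∉qbr ∘ ∈-++⁺ˡ) (b∉paq ∘ ∈-++⁺ʳ p ∘ there)) (neither (a∉qbr ∘ ∈-++⁺ʳ q ∘ there) b∉r)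
      where
      neither : ∀ {l} → a ∉ l → b ∉ l → All (λ x → ¬ (x ≡ a ⊎ x ≡ b)) l
      neither a∉ b∉ = All.tabulate λ { x∈ (inj₁ refl) → a∉ x∈ ; x∈ (inj₂ refl) → b∉ x∈ }
      a∉p = proj₁ (unique-∉-split p u)
      a∉qbr = proj₂ (unique-∉-split p u)
      u′ : Unique ((p ++ a ∷ q) ++ b ∷ r)
      u′ = subst Unique (sym (++-assoc p (a ∷ q) (b ∷ r))) u
      b∉paq = proj₁ (unique-∉-split (p ++ a ∷ q) u′)
      b∉p = b∉paq ∘ ∈-++⁺ˡ
      b∉r = proj₂ (unique-∉-split (p ++ a ∷ q) u′)

    unique⇒filter-oneOf-shape : ∀ {u a b} → Unique u → a ∈ u → b ∈ u → a ≢ b →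
      filter (oneOf? a b) u ≡ a ∷ b ∷ [] ⊎ filter (oneOf? a b) u ≡ b ∷ a ∷ []
    unique⇒filter-oneOf-shape {a = a} {b} uu a∈ b∈ a≢b with ∈-∃++ a∈
    ... | p , q , refl with locate {p = p} refl b∈
    ... | inj₂ (inj₁ refl) = ⊥-elim (a≢b refl)
    ... | inj₂ (inj₂ b∈q) with ∈-∃++ b∈q
    ...   | q₁ , q₂ , refl = inj₁ (unique⇒filter-oneOf p a q₁ b q₂ uu)
    unique⇒filter-oneOf-shape {a = a} {b} uu a∈ b∈ a≢b | p , q , refl | inj₁ b∈p with ∈-∃++ b∈p
    ...   | p₁ , p₂ , refl = inj₂ (trans (oneOf-comm ((p₁ ++ b ∷ p₂) ++ a ∷ q))
                                    (subst (λ l → filter (oneOf? b a) l ≡ b ∷ a ∷ []) (sym assoc)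
                                      (unique⇒filter-oneOf p₁ b p₂ a q (subst Unique assoc uu))))
      where
      assoc : (p₁ ++ b ∷ p₂) ++ a ∷ q ≡ p₁ ++ b ∷ p₂ ++ a ∷ q
      assoc = ++-assoc p₁ (b ∷ p₂) (a ∷ q)

    consecutive-order⇒≡ : ∀ (w w′ : List A) → Unique w → w′ ↭ w →
      (∀ p a b q → w ≡ p ++ a ∷ b ∷ q → filter (oneOf? a b) w′ ≡ a ∷ b ∷ []) → w′ ≡ w
    consecutive-order⇒≡ [] w′ _ w′↭ _ = ↭.↭-empty-inv w′↭
    consecutive-order⇒≡ (a ∷ []) w′ _ w′↭ _ = ↭.↭-singleton-inv w′↭
    consecutive-order⇒≡ (a ∷ b ∷ r) [] _ w′↭ _ with ↭.↭-length w′↭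
    ... | ()
    consecutive-order⇒≡ (a ∷ b ∷ r) (x ∷ w″) uw@(a∉ ∷ u) w′↭ ordered with x ≟ a
    ... | yes refl = cong (x ∷_) (consecutive-order⇒≡ (b ∷ r) w″ u (↭.drop-∷ w′↭) ordered′)
      where
      ordered′ : ∀ p c d q → b ∷ r ≡ p ++ c ∷ d ∷ q → filter (oneOf? c d) w″ ≡ c ∷ d ∷ []
      ordered′ p c d q eq = trans (sym (filter-reject (oneOf? c d) x∉cd)) (ordered (x ∷ p) c d q (cong (x ∷_) eq))
        where
        x∉cd : ¬ (x ≡ c ⊎ x ≡ d)
        x∉cd (inj₁ refl) = All.lookup a∉ (subst (x ∈_) (sym eq) (∈-++⁺ʳ p (here refl))) refl
        x∉cd (inj₂ refl) = All.lookup a∉ (subst (x ∈_) (sym eq) (∈-++⁺ʳ p (there (here refl)))) refl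
    ... | no x≢a with ↭.∈-resp-↭ w′↭ (here refl)
    ...   | here x≡a = ⊥-elim (x≢a x≡a)
    ...   | there x∈br with predecessor a (b ∷ r) x∈br
    ...     | p , y , q , eq = ⊥-elim (proj₂ (unique-∉-split p (subst Unique eq uw)) (here (sym x≡y)))
      where
      x≡y : x ≡ y
      x≡y = proj₁ (∷-injective (trans (sym (filter-accept (oneOf? y x) (inj₂ refl))) (ordered p y x q eq)))

  module _ {A : Set} {P : A → Set} (P? : Decidable P) where

    filter-length-mono : ∀ x (xs : List A) → length (filter P? xs) ≤ length (filter P? (x ∷ xs))
    filter-length-mono x xs with P? x
    ... | yes _ = ℕₚ.n≤1+n _
    ... | no _ = ℕₚ.≤-refl

    filter-length≥2 : ∀ (xs : List A) {p q : Fin (length xs)} → p ≢ q →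
      P (lookup xs p) → P (lookup xs q) → 2 ≤ length (filter P? xs)
    filter-length≥2 (x ∷ xs) {zero} {zero} p≢q _ _ = ⊥-elim (p≢q refl)
    filter-length≥2 (x ∷ xs) {zero} {suc q} _ Px Pq rewrite filter-accept P? {xs = xs} Px =
      s≤s (filter-some P? (lose (∈-lookup {xs = xs} q) Pq))
    filter-length≥2 (x ∷ xs) {suc p} {zero} _ Pp Px rewrite filter-accept P? {xs = xs} Px =
      s≤s (filter-some P? (lose (∈-lookup {xs = xs} p) Pp))
    filter-length≥2 (x ∷ xs) {suc p} {suc q} p≢q Pp Pq =
      ℕₚ.≤-trans (filter-length≥2 xs (p≢q ∘ cong suc) Pp Pq) (filter-length-mono x xs)

    filter-none-lookup : ∀ (xs : List A) → (∀ p → ¬ P (lookup xs p)) → length (filter P? xs) ≡ 0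
    filter-none-lookup xs none =
      cong length (filter-none P? (All.tabulate λ {x} (x∈ : x ∈ xs) Px → none (index x∈) (subst P (lookup-index x∈) Px)))

    filter-length≤1 : ∀ (xs : List A) (q : Fin (length xs)) → (∀ p → P (lookup xs p) → p ≡ q) →
      length (filter P? xs) ≤ 1
    filter-length≤1 (x ∷ xs) zero only-zero with P? x
    ... | yes _ = s≤s (ℕₚ.≤-reflexive (filter-none-lookup xs λ p Pp → Fₚ.0≢1+n (sym (only-zero (suc p) Pp))))
    ... | no _ = ℕₚ.≤-trans (ℕₚ.≤-reflexive (filter-none-lookup xs λ p Pp → Fₚ.0≢1+n (sym (only-zero (suc p) Pp)))) z≤n
    filter-length≤1 (x ∷ xs) (suc q) only-q rewrite filter-reject P? {xs = xs} (λ Px → Fₚ.0≢1+n (only-q zero Px)) =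
      filter-length≤1 xs q (λ p Pp → Fₚ.suc-injective (only-q (suc p) Pp))

  module _ {A : Set} where

    lookup-injective⇒unique : ∀ (xs : List A) → (∀ p q → lookup xs p ≡ lookup xs q → p ≡ q) → Unique xs
    lookup-injective⇒unique [] _ = []
    lookup-injective⇒unique (x ∷ xs) inj =
      All.tabulate fresh ∷ lookup-injective⇒unique xs (λ p q eq → Fₚ.suc-injective (inj (suc p) (suc q) eq))
      where
      fresh : ∀ {y} → y ∈ xs → x ≢ y
      fresh y∈ refl = Fₚ.0≢1+n (inj zero (suc (index y∈)) (lookup-index y∈))

    minimum-∈ : (f : A → ℕ) {xs : List A} {x : A} → x ∈ xs → ∃ λ m → m ∈ xs × All (λ y → f m ≤ f y) xs
    minimum-∈ f {y ∷ ys} _ =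
      argmin f y ys , [ (λ m≡y → here m≡y) , there ]′ (argmin-sel f y ys) ,
      f[argmin]≤f[⊤] {f = f} y ys ∷ f[argmin]≤f[xs] {f = f} y ys

    maximum-∈ : (f : A → ℕ) {xs : List A} {x : A} → x ∈ xs → ∃ λ m → m ∈ xs × All (λ y → f y ≤ f m) xs
    maximum-∈ f {y ∷ ys} _ =
      argmax f y ys , [ (λ m≡y → here m≡y) , there ]′ (argmax-sel f y ys) ,
      f[⊥]≤f[argmax] {f = f} y ys ∷ f[xs]≤f[argmax] {f = f} y ys

    filterᵇ-does : ∀ {P : A → Set} (P? : Decidable P) (xs : List A) → filterᵇ (does ∘ P?) xs ≡ filter P? xs
    filterᵇ-does P? [] = refl
    filterᵇ-does P? (x ∷ xs) with does (P? x)
    ... | true = cong (x ∷_) (filterᵇ-does P? xs)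
    ... | false = filterᵇ-does P? xs

    Before : List A → A → A → Set
    Before w x y = ∃ λ p → ∃ λ q → w ≡ p ++ x ∷ q × y ∈ q

    before-split⁺ʳ : ∀ {w p q : List A} {a b} → w ≡ p ++ a ∷ q → b ∈ q → Before w a b
    before-split⁺ʳ eq b∈q = _ , _ , eq , b∈q

    before-split⁺ˡ : ∀ {w p q : List A} {a b} → w ≡ p ++ a ∷ q → b ∈ p → Before w b a
    before-split⁺ˡ {p = p} {q} {a} refl b∈p with ∈-∃++ b∈p
    ... | p₁ , p₂ , refl = p₁ , p₂ ++ a ∷ q , ++-assoc p₁ (_ ∷ p₂) (a ∷ q) , ∈-++⁺ʳ p₂ (here refl)

    private
      index-++⁺ʳ : ∀ {x} (p : List A) {q} (x∈ : x ∈ q) → toℕ (index (∈-++⁺ʳ p x∈)) ≡ length p + toℕ (index x∈)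
      index-++⁺ʳ [] x∈ = refl
      index-++⁺ʳ (y ∷ p) x∈ = cong suc (index-++⁺ʳ p x∈)

    before⇒index< : ∀ {w : List A} {x y} → Unique w → Before w x y → (x∈ : x ∈ w) (y∈ : y ∈ w) →
      toℕ (index x∈) < toℕ (index y∈)
    before⇒index< {x = x} {y} uw (p , q , refl , y∈q) x∈ y∈ =
      subst₂ _<_ (sym (trans (cong (toℕ ∘ index) (unique⇒irrelevant uw x∈ (∈-++⁺ʳ p (here refl))))
                             (trans (index-++⁺ʳ p (here refl)) (ℕₚ.+-identityʳ _))))
                 (sym (trans (cong (toℕ ∘ index) (unique⇒irrelevant uw y∈ (∈-++⁺ʳ p (there y∈q))))
                             (index-++⁺ʳ p (there y∈q))))
                 (ℕₚ.m<m+n (length p) (s≤s z≤n))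

    before-∈ˡ : ∀ {w : List A} {x y} → Before w x y → x ∈ w
    before-∈ˡ (p , q , refl , _) = ∈-++⁺ʳ p (here refl)

    before-∈ʳ : ∀ {w : List A} {x y} → Before w x y → y ∈ w
    before-∈ʳ (p , q , refl , y∈q) = ∈-++⁺ʳ p (there y∈q)

    before-asym : ∀ {w : List A} {x y} → Unique w → Before w x y → Before w y x → ⊥
    before-asym uw xy yx =
      ℕₚ.<-asym (before⇒index< uw xy (before-∈ˡ xy) (before-∈ʳ xy)) (before⇒index< uw yx (before-∈ʳ xy) (before-∈ˡ xy))

    before-cycle₃ : ∀ {w : List A} {x y z} → Unique w → Before w x y → Before w y z → Before w z x → ⊥
    before-cycle₃ uw xy yz zx =
      ℕₚ.<-irrefl refl (ℕₚ.<-trans (before⇒index< uw xy (before-∈ˡ xy) (before-∈ˡ yz))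
                         (ℕₚ.<-trans (before⇒index< uw yz (before-∈ˡ yz) (before-∈ˡ zx)) (before⇒index< uw zx (before-∈ˡ zx) (before-∈ˡ xy))))

module Orderings where

  open import Data.Nat using (suc; _*_; _!)
  open import Data.Nat.Properties using (*-comm)
  open import Data.List using (List; []; _∷_; _++_; map; length)
  open import Data.List.Properties using (length-map; ∷-injective)
  open import Data.List.Membership.Propositional using (_∈_; _∉_)
  open import Data.List.Membership.Propositional.Properties using (∈-map⁺; ∈-map⁻; ∈-∃++; ∈-++⁺ˡ)
  open import Data.List.Relation.Unary.Any using (here; there)
  import Data.List.Relation.Unary.All as All
  open import Data.List.Relation.Unary.AllPairs using ([]; _∷_)
  open import Data.List.Relation.Unary.All using ([])
  open import Data.List.Relation.Unary.Unique.Propositional using (Unique)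
  import Data.List.Relation.Unary.Unique.Propositional.Properties as Unique
  open import Data.List.Relation.Binary.Permutation.Propositional using (_↭_; ↭-refl; ↭-sym; ↭-trans; ↭-prep)
  import Data.List.Relation.Binary.Permutation.Propositional.Properties as ↭
  open import Data.Product using (_×_; _,_; proj₁; proj₂; ∃)
  open import Function using (_∘_)
  open import Relation.Binary.PropositionalEquality using (_≡_; _≢_; refl; trans; cong)
  open import Defs using (insertAll; orderings)
  open ListFacts

  module _ {A : Set} where

    insertAll-∈⁻ : ∀ (x : A) (u : List A) {w} → w ∈ insertAll x u →
      ∃ λ p → ∃ λ q → u ≡ p ++ q × w ≡ p ++ x ∷ q
    insertAll-∈⁻ x [] (here refl) = [] , [] , refl , refl
    insertAll-∈⁻ x (y ∷ ys) (here refl) = [] , y ∷ ys , refl , refl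
    insertAll-∈⁻ x (y ∷ ys) (there w∈) with ∈-map⁻ (y ∷_) w∈
    ... | w′ , w′∈ , refl with insertAll-∈⁻ x ys w′∈
    ... | p , q , refl , refl = y ∷ p , q , refl , refl

    insertAll-∈⁺ : ∀ (x : A) (p q : List A) → p ++ x ∷ q ∈ insertAll x (p ++ q)
    insertAll-∈⁺ x [] [] = here refl
    insertAll-∈⁺ x [] (y ∷ q) = here refl
    insertAll-∈⁺ x (y ∷ p) q = there (∈-map⁺ (y ∷_) (insertAll-∈⁺ x p q))

    length-insertAll : ∀ (x : A) (u : List A) → length (insertAll x u) ≡ suc (length u)
    length-insertAll x [] = refl
    length-insertAll x (y ∷ ys) = cong suc (trans (length-map (y ∷_) (insertAll x ys)) (length-insertAll x ys))

    unique-insertAll : ∀ (x : A) (u : List A) → x ∉ u → Unique u → Unique (insertAll x u)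
    unique-insertAll x [] _ _ = [] ∷ []
    unique-insertAll x (y ∷ ys) x∉ (_ ∷ uys) =
      All.tabulate head≢ ∷ Unique.map⁺ (proj₂ ∘ ∷-injective) (unique-insertAll x ys (x∉ ∘ there) uys)
      where
      head≢ : ∀ {w} → w ∈ map (y ∷_) (insertAll x ys) → x ∷ y ∷ ys ≢ w
      head≢ w∈ eq with ∈-map⁻ (y ∷_) w∈
      ... | _ , _ , refl = x∉ (here (proj₁ (∷-injective eq)))

    orderings-↭ : ∀ (xs : List A) {w} → w ∈ orderings xs → w ↭ xs
    orderings-↭ [] (here refl) = ↭-refl
    orderings-↭ (x ∷ xs) w∈ with ∈-concatMap⁻′ (insertAll x) (orderings xs) w∈
    ... | u , u∈ , w∈′ with insertAll-∈⁻ x u w∈′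
    ... | p , q , refl , refl = ↭-trans (↭.shift x p q) (↭-prep x (orderings-↭ xs u∈))

    ↭⇒∈-orderings : ∀ (xs : List A) {w} → w ↭ xs → w ∈ orderings xs
    ↭⇒∈-orderings [] {[]} _ = here refl
    ↭⇒∈-orderings [] {_ ∷ _} w↭ with ↭.↭-length w↭
    ... | ()
    ↭⇒∈-orderings (x ∷ xs) w↭ with ∈-∃++ (↭.∈-resp-↭ (↭-sym w↭) (here refl))
    ... | p , q , refl =
      ∈-concatMap⁺′ (insertAll x) (↭⇒∈-orderings xs (↭.drop-∷ (↭-trans (↭-sym (↭.shift x p q)) w↭)))
        (insertAll-∈⁺ x p q)

    unique-orderings : ∀ (xs : List A) → Unique xs → Unique (orderings xs)
    unique-orderings [] _ = [] ∷ []
    unique-orderings (x ∷ xs) (x∉xs ∷ u) =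
      unique-concatMap (insertAll x) (orderings xs) (unique-orderings xs u)
        (λ w∈ → unique-insertAll x _ (x∉ w∈) (unique-resp-↭ u (↭-sym (orderings-↭ xs w∈))))
        same-base
      where
      x∉ : ∀ {w} → w ∈ orderings xs → x ∉ w
      x∉ w∈ x∈w = All.lookup x∉xs (↭.∈-resp-↭ (orderings-↭ xs w∈) x∈w) refl
      same-base : ∀ {a b z} → a ∈ orderings xs → b ∈ orderings xs →
        z ∈ insertAll x a → z ∈ insertAll x b → a ≡ b
      same-base a∈ b∈ za zb with insertAll-∈⁻ x _ za | insertAll-∈⁻ x _ zb
      ... | p , q , refl , refl | p′ , q′ , refl , eq
        with split-injective p q p′ q′ eq (x∉ a∈ ∘ ∈-++⁺ˡ) (x∉ b∈ ∘ ∈-++⁺ˡ)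
      ... | refl , refl = refl

    length-orderings : ∀ (xs : List A) → length (orderings xs) ≡ length xs !
    length-orderings [] = refl
    length-orderings (x ∷ xs) =
      trans (length-concatMap-const (insertAll x) (suc (length xs)) (orderings xs)
              (λ {w} w∈ → trans (length-insertAll x w) (cong suc (↭.↭-length (orderings-↭ xs w∈)))))
        (trans (cong (_* suc (length xs)) (length-orderings xs)) (*-comm (length xs !) (suc (length xs))))

module MultiplicityOne where

  open import Data.Nat using (zero; suc)
  import Data.Nat as ℕ
  open import Data.Fin using (Fin; _≟_)
  open import Data.Vec using (Vec; []; _∷_)
  import Data.Vec.Properties as Vecₚ
  open import Data.List using (map; filter; length; allFin)
  open import Data.List.Properties using (length-map)
  open import Data.List.Membership.Propositional using (_∈_)
  open import Data.List.Membership.Propositional.Properties using (∈-map⁺; ∈-map⁻; ∈-filter⁺; ∈-filter⁻; ∈-allFin)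
  open import Data.List.Relation.Unary.Any using (here)
  open import Data.List.Relation.Unary.AllPairs using ([]; _∷_)
  open import Data.List.Relation.Unary.All using ([])
  open import Data.List.Relation.Unary.Unique.Propositional using (Unique)
  import Data.List.Relation.Unary.Unique.Propositional.Properties as Unique
  open import Data.Product using (_,_; proj₁; proj₂)
  open import Function using (_∘_)
  open import Relation.Binary.PropositionalEquality using (_≡_; refl; sym; trans)
  open import Relation.Nullary using (Dec)
  open import Defs
  open ListFacts
  open Orderings

  allVecs-complete : ∀ {n} k (σ : Vec (Fin n) k) → σ ∈ allVecs k
  allVecs-complete zero [] = here refl
  allVecs-complete (suc k) (x ∷ σ) = ∈-concatMap⁺′ _ (∈-allFin x) (∈-map⁺ (x ∷_) (allVecs-complete k σ))

  unique-allVecs : ∀ {n} k → Unique (allVecs {n} k)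
  unique-allVecs zero = [] ∷ []
  unique-allVecs {n} (suc k) =
    unique-concatMap _ (allFin n) (Unique.allFin⁺ n)
      (λ _ → Unique.map⁺ (proj₂ ∘ Vecₚ.∷-injective) (unique-allVecs k))
      same-head
    where
    same-head : ∀ {x y σ} → x ∈ allFin n → y ∈ allFin n →
      σ ∈ map (x ∷_) (allVecs k) → σ ∈ map (y ∷_) (allVecs k) → x ≡ y
    same-head _ _ σx σy with ∈-map⁻ _ σx | ∈-map⁻ _ σy
    ... | _ , _ , refl | _ , _ , eq = proj₁ (Vecₚ.∷-injective eq)

  module _ {n} (E : Edges n) where

    hasMultiplicityOne? : (w : Edges n) → Dec (multiplicity E (prodPerm w) ≡ 1)
    hasMultiplicityOne? w = multiplicity E (prodPerm w) ℕ.≟ 1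

    numMultOne≡#orderingsOfMultiplicityOne : Unique E →
      numMultOne E ≡ length (filter hasMultiplicityOne? (orderings E))
    numMultOne≡#orderingsOfMultiplicityOne uE =
      trans (unique-sameElements⇒length≡ (Unique.filter⁺ mult1? (unique-allVecs n)) unique-products sound complete)
            (length-map prodPerm (filter hasMultiplicityOne? (orderings E)))
      where
      mult1? : (σ : Perm n) → Dec (multiplicity E σ ≡ 1)
      mult1? σ = multiplicity E σ ℕ.≟ 1
      sameProduct? : (σ : Perm n) (w : Edges n) → Dec (prodPerm w ≡ σ)
      sameProduct? σ w = Vecₚ.≡-dec _≟_ (prodPerm w) σ
      unique-products : Unique (map prodPerm (filter hasMultiplicityOne? (orderings E)))
      unique-products = unique-map-injectiveOn prodPerm _ (Unique.filter⁺ hasMultiplicityOne? (unique-orderings E uE)) inj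
        where
        inj : ∀ {a b} → a ∈ filter hasMultiplicityOne? (orderings E) → b ∈ filter hasMultiplicityOne? (orderings E) →
          prodPerm a ≡ prodPerm b → a ≡ b
        inj {a} a∈ b∈ eq with ∈-filter⁻ hasMultiplicityOne? {xs = orderings E} a∈ | ∈-filter⁻ hasMultiplicityOne? {xs = orderings E} b∈
        ... | a∈o , mult≡1 | b∈o , _ =
          length≡1⇒≡ mult≡1 (∈-filter⁺ (sameProduct? (prodPerm a)) a∈o refl) (∈-filter⁺ (sameProduct? (prodPerm a)) b∈o (sym eq))
      sound : ∀ {σ} → σ ∈ filter mult1? (allVecs n) → σ ∈ map prodPerm (filter hasMultiplicityOne? (orderings E))
      sound {σ} σ∈ with ∈-filter⁻ mult1? {xs = allVecs n} σ∈
      ... | _ , mult≡1 with length≡1⇒∈ mult≡1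
      ... | w , w∈ with ∈-filter⁻ (sameProduct? σ) {xs = orderings E} w∈
      ... | w∈o , refl = ∈-map⁺ prodPerm (∈-filter⁺ hasMultiplicityOne? w∈o mult≡1)
      complete : ∀ {σ} → σ ∈ map prodPerm (filter hasMultiplicityOne? (orderings E)) → σ ∈ filter mult1? (allVecs n)
      complete σ∈ with ∈-map⁻ prodPerm σ∈
      ... | w , w∈ , refl =
        ∈-filter⁺ mult1? (allVecs-complete n _) (proj₂ (∈-filter⁻ hasMultiplicityOne? {xs = orderings E} w∈))

module Transpositions where

  open import Data.Nat using (ℕ)
  open import Data.Fin using (Fin; _≟_)
  open import Data.Fin.Permutation.Components using (transpose; transpose-inverse)
  open import Data.List using ([]; _∷_; _++_)
  open import Data.List.Relation.Unary.All using (All; []; _∷_)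
  open import Data.Product using (_×_; _,_; proj₁; proj₂; ∃; swap)
  open import Data.Sum using (_⊎_; inj₁; inj₂)
  open import Data.Empty using (⊥-elim)
  open import Function using (_∘_; flip; Injective)
  open import Relation.Binary.PropositionalEquality
    using (_≡_; _≢_; refl; sym; trans; cong; ≢-sym; module ≡-Reasoning)
  open import Relation.Nullary using (¬_; Dec; yes; no)
  open import Relation.Nullary.Decidable using (_⊎-dec_)
  open import Defs

  module _ {n : ℕ} where

    transpose-matchˡ : (i j : Fin n) → transpose i j i ≡ j
    transpose-matchˡ i j with i ≟ i
    ... | yes _ = refl
    ... | no i≢i = ⊥-elim (i≢i refl)

    transpose-matchʳ : (i j : Fin n) → transpose i j j ≡ i
    transpose-matchʳ i j with j ≟ i
    ... | yes j≡i = j≡i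
    ... | no _ with j ≟ j
    ...   | yes _ = refl
    ...   | no j≢j = ⊥-elim (j≢j refl)

    transpose-other : (i j : Fin n) {k : Fin n} → k ≢ i → k ≢ j → transpose i j k ≡ k
    transpose-other i j {k} k≢i k≢j with k ≟ i
    ... | yes k≡i = ⊥-elim (k≢i k≡i)
    ... | no _ with k ≟ j
    ...   | yes k≡j = ⊥-elim (k≢j k≡j)
    ...   | no _ = refl

    data TransposeView (i j : Fin n) : Fin n → Set where
      atˡ : TransposeView i j i
      atʳ : i ≢ j → TransposeView i j j
      elsewhere : ∀ {k} → k ≢ i → k ≢ j → TransposeView i j k

    transposeView : (i j k : Fin n) → TransposeView i j k
    transposeView i j k with k ≟ i
    ... | yes refl = atˡ
    ... | no k≢i with k ≟ j
    ...   | yes refl = atʳ (≢-sym k≢i)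
    ...   | no k≢j = elsewhere k≢i k≢j

    transpose-comm : (i j k : Fin n) → transpose i j k ≡ transpose j i k
    transpose-comm i j k with transposeView i j k
    ... | atˡ = trans (transpose-matchˡ i j) (sym (transpose-matchʳ j i))
    ... | atʳ _ = trans (transpose-matchʳ i j) (sym (transpose-matchˡ j i))
    ... | elsewhere k≢i k≢j = trans (transpose-other i j k≢i k≢j) (sym (transpose-other j i k≢j k≢i))

    transpose-involutive : (i j k : Fin n) → transpose i j (transpose i j k) ≡ k
    transpose-involutive i j k = trans (cong (transpose i j) (transpose-comm i j k)) (transpose-inverse i j)

    transpose-injective : (i j : Fin n) → Injective _≡_ _≡_ (transpose i j)
    transpose-injective i j {a} {b} eq =
      trans (sym (transpose-involutive i j a)) (trans (cong (transpose i j) eq) (transpose-involutive i j b))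

    private
      commute-via : ∀ {a b c d k x y z : Fin n} → transpose c d k ≡ x → transpose a b x ≡ z →
        transpose a b k ≡ y → transpose c d y ≡ z → transpose a b (transpose c d k) ≡ transpose c d (transpose a b k)
      commute-via {a} {b} {c} {d} cd-k ab-x ab-k cd-y =
        trans (cong (transpose a b) cd-k) (trans ab-x (sym (trans (cong (transpose c d) ab-k) cd-y)))

    transpose-disjoint-comm : ∀ {a b c d : Fin n} → a ≢ c → a ≢ d → b ≢ c → b ≢ d → ∀ k →
      transpose a b (transpose c d k) ≡ transpose c d (transpose a b k)
    transpose-disjoint-comm {a} {b} {c} {d} a≢c a≢d b≢c b≢d k with transposeView c d k
    ... | atˡ = commute-via {k = c} (transpose-matchˡ c d) (transpose-other a b (≢-sym a≢d) (≢-sym b≢d))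
                            (transpose-other a b (≢-sym a≢c) (≢-sym b≢c)) (transpose-matchˡ c d)
    ... | atʳ _ = commute-via {k = d} (transpose-matchʳ c d) (transpose-other a b (≢-sym a≢c) (≢-sym b≢c))
                              (transpose-other a b (≢-sym a≢d) (≢-sym b≢d)) (transpose-matchʳ c d)
    ... | elsewhere k≢c k≢d with transposeView a b k
    ...   | atˡ = commute-via {k = a} (transpose-other c d k≢c k≢d) (transpose-matchˡ a b) (transpose-matchˡ a b) (transpose-other c d b≢c b≢d)
    ...   | atʳ _ = commute-via {k = b} (transpose-other c d k≢c k≢d) (transpose-matchʳ a b) (transpose-matchʳ a b) (transpose-other c d a≢c a≢d)
    ...   | elsewhere k≢a k≢b =
      commute-via {k = k} (transpose-other c d k≢c k≢d) (transpose-other a b k≢a k≢b) (transpose-other a b k≢a k≢b) (transpose-other c d k≢c k≢d)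

    Incident : Fin n → Fin n × Fin n → Set
    Incident u g = proj₁ g ≡ u ⊎ proj₂ g ≡ u

    incident? : (u : Fin n) (g : Fin n × Fin n) → Dec (Incident u g)
    incident? u g = (proj₁ g ≟ u) ⊎-dec (proj₂ g ≟ u)

    Joins : Fin n → Fin n → Fin n × Fin n → Set
    Joins a b g = g ≡ (a , b) ⊎ g ≡ (b , a)

    joins-incidentˡ : ∀ {a b g} → Joins a b g → Incident a g
    joins-incidentˡ (inj₁ refl) = inj₁ refl
    joins-incidentˡ (inj₂ refl) = inj₂ refl

    joins-incidentʳ : ∀ {a b g} → Joins a b g → Incident b g
    joins-incidentʳ (inj₁ refl) = inj₂ refl
    joins-incidentʳ (inj₂ refl) = inj₁ refl

    joins-incident : ∀ {a b g y} → Joins a b g → Incident y g → y ≡ a ⊎ y ≡ b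
    joins-incident (inj₁ refl) (inj₁ refl) = inj₁ refl
    joins-incident (inj₁ refl) (inj₂ refl) = inj₂ refl
    joins-incident (inj₂ refl) (inj₁ refl) = inj₂ refl
    joins-incident (inj₂ refl) (inj₂ refl) = inj₁ refl

    Share : Fin n × Fin n → Fin n × Fin n → Set
    Share g h = ∃ λ u → Incident u g × Incident u h

    share-sym : ∀ {g h} → Share g h → Share h g
    share-sym (u , ig , ih) = u , ih , ig

    transpose-avoiding : ∀ {u} g → ¬ Incident u g → transpose (proj₁ g) (proj₂ g) u ≡ u
    transpose-avoiding (a , b) ¬inc = transpose-other a b (¬inc ∘ inj₁ ∘ sym) (¬inc ∘ inj₂ ∘ sym)

    prodFun-++ : ∀ (p q : Edges n) z → prodFun (p ++ q) z ≡ prodFun p (prodFun q z)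
    prodFun-++ [] q z = refl
    prodFun-++ ((a , b) ∷ p) q z = cong (transpose a b) (prodFun-++ p q z)

    prodFun-injective : ∀ (p : Edges n) → Injective _≡_ _≡_ (prodFun p)
    prodFun-injective [] eq = eq
    prodFun-injective ((a , b) ∷ p) eq = prodFun-injective p (transpose-injective a b eq)

    prodFun-avoiding : ∀ {u} (p : Edges n) → All (¬_ ∘ Incident u) p → prodFun p u ≡ u
    prodFun-avoiding [] [] = refl
    prodFun-avoiding ((a , b) ∷ p) (¬inc ∷ ¬incs) =
      trans (cong (transpose a b) (prodFun-avoiding p ¬incs)) (transpose-avoiding (a , b) ¬inc)

    prodFun-flip-mid : ∀ (p q : Edges n) a b z → prodFun (p ++ (a , b) ∷ q) z ≡ prodFun (p ++ (b , a) ∷ q) z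
    prodFun-flip-mid [] q a b z = transpose-comm a b (prodFun q z)
    prodFun-flip-mid ((c , d) ∷ p) q a b z = cong (transpose c d) (prodFun-flip-mid p q a b z)

    prodFun-swap-disjoint : ∀ (p q : Edges n) g h → ¬ Share g h → ∀ z →
      prodFun (p ++ g ∷ h ∷ q) z ≡ prodFun (p ++ h ∷ g ∷ q) z
    prodFun-swap-disjoint [] q (a , b) (c , d) ¬share z =
      transpose-disjoint-comm (λ { refl → ¬share (a , inj₁ refl , inj₁ refl) }) (λ { refl → ¬share (a , inj₁ refl , inj₂ refl) })
                              (λ { refl → ¬share (b , inj₂ refl , inj₁ refl) }) (λ { refl → ¬share (b , inj₂ refl , inj₂ refl) })
                              (prodFun q z)
    prodFun-swap-disjoint ((a , b) ∷ p) q g h ¬share z = cong (transpose a b) (prodFun-swap-disjoint p q g h ¬share z)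

    SameEdge : Fin n × Fin n → Fin n × Fin n → Set
    SameEdge g h = g ≡ h ⊎ g ≡ swap h

    -- Two distinct edges at a common vertex u, to x and to y, send u to y and to x in the two orders.
    transpose-sharing-noncomm : ∀ g h → proj₁ g ≢ proj₂ g → proj₁ h ≢ proj₂ h → Share g h → ¬ SameEdge g h →
      ¬ (∀ z → prodFun (g ∷ h ∷ []) z ≡ prodFun (h ∷ g ∷ []) z)
    transpose-sharing-noncomm (a , b) (c , d) a≢b c≢d (u , inc-g , inc-h) ¬same comm
      with oriented a b a≢b inc-g | oriented c d c≢d inc-h
      where
      oriented : ∀ a b → a ≢ b → Incident u (a , b) →
        ∃ λ x → x ≢ u × (∀ z → transpose a b z ≡ transpose u x z) × ((a , b) ≡ (u , x) ⊎ (a , b) ≡ (x , u))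
      oriented a b a≢b (inj₁ refl) = b , ≢-sym a≢b , (λ _ → refl) , inj₁ refl
      oriented a b a≢b (inj₂ refl) = a , a≢b , transpose-comm a b , inj₂ refl
    ... | x , x≢u , tg , g≈ | y , y≢u , th , h≈ = ¬same (same g≈ h≈ x≡y)
      where
      open ≡-Reasoning
      x≡y : x ≡ y
      x≡y with x ≟ y
      ... | yes x≡y = x≡y
      ... | no x≢y = begin
        x                                   ≡⟨ sym (transpose-other u y x≢u x≢y) ⟩
        transpose u y x                     ≡⟨ cong (transpose u y) (sym (transpose-matchˡ u x)) ⟩
        transpose u y (transpose u x u)     ≡⟨ sym (trans (th (transpose a b u)) (cong (transpose u y) (tg u))) ⟩
        transpose c d (transpose a b u)     ≡⟨ sym (comm u) ⟩
        transpose a b (transpose c d u)     ≡⟨ trans (tg (transpose c d u)) (cong (transpose u x) (th u)) ⟩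
        transpose u x (transpose u y u)     ≡⟨ cong (transpose u x) (transpose-matchˡ u y) ⟩
        transpose u x y                     ≡⟨ transpose-other u x y≢u (≢-sym x≢y) ⟩
        y                                   ∎
      same : (a , b) ≡ (u , x) ⊎ (a , b) ≡ (x , u) → (c , d) ≡ (u , y) ⊎ (c , d) ≡ (y , u) → x ≡ y →
        SameEdge (a , b) (c , d)
      same (inj₁ refl) (inj₁ refl) refl = inj₁ refl
      same (inj₁ refl) (inj₂ refl) refl = inj₂ refl
      same (inj₂ refl) (inj₁ refl) refl = inj₂ refl
      same (inj₂ refl) (inj₂ refl) refl = inj₁ refl

    -- splice σ y cuts y out of its cycle: y becomes fixed and σ⁻¹ y is sent to σ y.
    splice : (Fin n → Fin n) → Fin n → Fin n → Fin n
    splice σ y z with z ≟ y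
    ... | yes _ = y
    ... | no _ with σ z ≟ y
    ...   | yes _ = σ y
    ...   | no _ = σ z

    splice-fixed : ∀ σ y → splice σ y y ≡ y
    splice-fixed σ y with y ≟ y
    ... | yes _ = refl
    ... | no y≢y = ⊥-elim (y≢y refl)

    splice-hit : ∀ σ y {z} → z ≢ y → σ z ≡ y → splice σ y z ≡ σ y
    splice-hit σ y {z} z≢y σz≡y with z ≟ y
    ... | yes z≡y = ⊥-elim (z≢y z≡y)
    ... | no _ with σ z ≟ y
    ...   | yes _ = refl
    ...   | no σz≢y = ⊥-elim (σz≢y σz≡y)

    splice-miss : ∀ σ y {z} → z ≢ y → σ z ≢ y → splice σ y z ≡ σ z
    splice-miss σ y {z} z≢y σz≢y with z ≟ y
    ... | yes z≡y = ⊥-elim (z≢y z≡y)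
    ... | no _ with σ z ≟ y
    ...   | yes σz≡y = ⊥-elim (σz≢y σz≡y)
    ...   | no _ = refl

    splice-cong : ∀ {σ τ} y → (∀ z → σ z ≡ τ z) → ∀ z → splice σ y z ≡ splice τ y z
    splice-cong {σ} {τ} y σ≗τ z = by-cases (z ≟ y) (σ z ≟ y)
      where
      by-cases : Dec (z ≡ y) → Dec (σ z ≡ y) → splice σ y z ≡ splice τ y z
      by-cases (yes z≡y) _ = trans (cong (splice σ y) z≡y)
        (trans (splice-fixed σ y) (sym (trans (cong (splice τ y) z≡y) (splice-fixed τ y))))
      by-cases (no z≢y) (yes σz≡y) =
        trans (splice-hit σ y z≢y σz≡y) (trans (σ≗τ y) (sym (splice-hit τ y z≢y (trans (sym (σ≗τ z)) σz≡y))))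
      by-cases (no z≢y) (no σz≢y) =
        trans (splice-miss σ y z≢y σz≢y) (trans (σ≗τ z) (sym (splice-miss τ y z≢y (σz≢y ∘ trans (σ≗τ z)))))

    splice-post : ∀ σ {τ} y → Injective _≡_ _≡_ τ → τ y ≡ y → ∀ z → splice (τ ∘ σ) y z ≡ τ (splice σ y z)
    splice-post σ {τ} y τ-inj τy≡y z = by-cases (z ≟ y) (σ z ≟ y)
      where
      by-cases : Dec (z ≡ y) → Dec (σ z ≡ y) → splice (τ ∘ σ) y z ≡ τ (splice σ y z)
      by-cases (yes z≡y) _ = trans (cong (splice (τ ∘ σ) y) z≡y)
        (trans (splice-fixed (τ ∘ σ) y) (sym (trans (cong (τ ∘ splice σ y) z≡y) (trans (cong τ (splice-fixed σ y)) τy≡y))))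
      by-cases (no z≢y) (yes σz≡y) =
        trans (splice-hit (τ ∘ σ) y z≢y (trans (cong τ σz≡y) τy≡y)) (sym (cong τ (splice-hit σ y z≢y σz≡y)))
      by-cases (no z≢y) (no σz≢y) =
        trans (splice-miss (τ ∘ σ) y z≢y (σz≢y ∘ τ-inj ∘ flip trans (sym τy≡y))) (sym (cong τ (splice-miss σ y z≢y σz≢y)))

    splice-pendant : ∀ {ρ} x y → Injective _≡_ _≡_ ρ → ρ y ≡ y → ∀ z → splice (transpose x y ∘ ρ) y z ≡ ρ z
    splice-pendant {ρ} x y ρ-inj ρy≡y z = by-cases (z ≟ y) (ρ z ≟ x)
      where
      by-cases : Dec (z ≡ y) → Dec (ρ z ≡ x) → splice (transpose x y ∘ ρ) y z ≡ ρ z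
      by-cases (yes z≡y) _ = trans (cong (splice _ y) z≡y) (trans (splice-fixed _ y) (sym (trans (cong ρ z≡y) ρy≡y)))
      by-cases (no z≢y) ρz≟x = by-image ρz≟x
        where
        ρz≢y : ρ z ≢ y
        ρz≢y ρz≡y = z≢y (ρ-inj (trans ρz≡y (sym ρy≡y)))
        by-image : Dec (ρ z ≡ x) → splice (transpose x y ∘ ρ) y z ≡ ρ z
        by-image (yes ρz≡x) = trans (splice-hit _ y z≢y (trans (cong (transpose x y) ρz≡x) (transpose-matchˡ x y)))
                                    (trans (cong (transpose x y) ρy≡y) (trans (transpose-matchʳ x y) (sym ρz≡x)))
        by-image (no ρz≢x) = trans (splice-miss _ y z≢y (ρz≢y ∘ trans (sym (transpose-other x y ρz≢x ρz≢y))))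
                                   (transpose-other x y ρz≢x ρz≢y)

    prodFun-delete-pendant : ∀ x y (p q : Edges n) → All (¬_ ∘ Incident y) p → All (¬_ ∘ Incident y) q →
      ∀ z → prodFun (p ++ q) z ≡ splice (prodFun (p ++ (x , y) ∷ q)) y z
    prodFun-delete-pendant x y p q p-avoids q-avoids z = sym (begin
      splice (prodFun (p ++ (x , y) ∷ q)) y z               ≡⟨ splice-cong y (prodFun-++ p ((x , y) ∷ q)) z ⟩
      splice (prodFun p ∘ prodFun ((x , y) ∷ q)) y z        ≡⟨ splice-post _ y (prodFun-injective p) (prodFun-avoiding p p-avoids) z ⟩
      prodFun p (splice (prodFun ((x , y) ∷ q)) y z)        ≡⟨ cong (prodFun p) (splice-pendant x y (prodFun-injective q) (prodFun-avoiding q q-avoids) z) ⟩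
      prodFun p (prodFun q z)                               ≡⟨ sym (prodFun-++ p q z) ⟩
      prodFun (p ++ q) z                                    ∎)
      where open ≡-Reasoning

module Chains where

  open import Data.Nat using (ℕ)
  open import Data.Fin using (Fin; _≟_)
  open import Data.Fin.Properties using (any?)
  open import Data.List using ([]; _∷_; _++_; filter; length; reverse)
  open import Data.List.Properties using (++-assoc; reverse-involutive; ∷-injective; ++-cancelˡ)
  open import Data.List.Membership.Propositional using (_∈_)
  open import Data.List.Membership.Propositional.Properties using (∈-filter⁺; ∈-filter⁻; ∈-++⁺ʳ)
  open import Data.List.Relation.Unary.Any using (here; there)
  open import Data.List.Relation.Unary.Linked using (Linked; []; [-]; _∷_; tail; linked?)
  open import Data.List.Relation.Unary.Unique.Propositional using (Unique)
  import Data.List.Relation.Unary.Unique.Propositional.Properties as Unique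
  open import Data.List.Relation.Binary.Permutation.Propositional using (_↭_; ↭-refl; ↭-sym; ↭-trans; ↭-swap)
  import Data.List.Relation.Binary.Permutation.Propositional.Properties as ↭
  open import Data.Product using (_×_; _,_; proj₁; proj₂; ∃)
  open import Data.Sum using (inj₁)
  open import Data.Empty using (⊥-elim)
  open import Data.Vec using (lookup)
  import Data.Vec.Properties as Vecₚ
  open import Relation.Binary.PropositionalEquality using (_≡_; _≢_; refl; sym; trans; cong; subst)
  open import Relation.Nullary using (¬_; Dec; yes; no)
  open import Relation.Nullary.Decidable using (_×-dec_)
  open import Function using (_∘_)
  open import Defs
  open ListFacts
  open Orderings
  open MultiplicityOne
  open Transpositions

  module _ {n : ℕ} where

    share? : (g h : Fin n × Fin n) → Dec (Share g h)
    share? g h = any? λ u → incident? u g ×-dec incident? u h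

    Chain : Edges n → Set
    Chain = Linked Share

    chain? : (w : Edges n) → Dec (Chain w)
    chain? = linked? share?

    chain-split⁻ : ∀ p {g h} q → Chain (p ++ g ∷ h ∷ q) → Share g h
    chain-split⁻ [] q (share ∷ _) = share
    chain-split⁻ (x ∷ p) q chain = chain-split⁻ p q (tail chain)

    chain-split⁺ : ∀ w → (∀ p g h q → w ≡ p ++ g ∷ h ∷ q → Share g h) → Chain w
    chain-split⁺ [] _ = []
    chain-split⁺ (x ∷ []) _ = [-]
    chain-split⁺ (x ∷ y ∷ w) shares =
      shares [] x y w refl ∷ chain-split⁺ (y ∷ w) (λ p g h q eq → shares (x ∷ p) g h q (cong (x ∷_) eq))

    ¬chain⇒split : ∀ w → ¬ Chain w → ∃ λ p → ∃ λ g → ∃ λ h → ∃ λ q → w ≡ p ++ g ∷ h ∷ q × ¬ Share g h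
    ¬chain⇒split [] ¬c = ⊥-elim (¬c [])
    ¬chain⇒split (g ∷ []) ¬c = ⊥-elim (¬c [-])
    ¬chain⇒split (g ∷ h ∷ r) ¬c with share? g h | ¬chain⇒split (h ∷ r)
    ... | no ¬share | _ = [] , g , h , r , refl , ¬share
    ... | yes share | split-rest with split-rest (¬c ∘ (share ∷_))
    ...   | p , g′ , h′ , q , eq , ¬share = g ∷ p , g′ , h′ , q , cong (g ∷_) eq , ¬share

    chain-prefix : ∀ p {x} q → Chain (p ++ x ∷ q) → Chain p
    chain-prefix p {x} q c = chain-split⁺ p λ p₁ a b p₂ eq →
      chain-split⁻ p₁ (p₂ ++ x ∷ q) (subst Chain (trans (cong (_++ x ∷ q) eq) (++-assoc p₁ (a ∷ b ∷ p₂) (x ∷ q))) c)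

    chain-suffix : ∀ p {x} q → Chain (p ++ x ∷ q) → Chain q
    chain-suffix p {x} q c = chain-split⁺ q λ q₁ a b q₂ eq →
      chain-split⁻ (p ++ x ∷ q₁) q₂ (subst Chain (trans (cong (λ l → p ++ x ∷ l) eq) (sym (++-assoc p (x ∷ q₁) (a ∷ b ∷ q₂)))) c)

    chain-reverse : ∀ w → Chain w → Chain (reverse w)
    chain-reverse w c = chain-split⁺ (reverse w) λ p a b q eq →
      share-sym (chain-split⁻ (reverse q) (reverse p)
        (subst Chain (trans (sym (reverse-involutive w)) (trans (cong reverse eq) (reverse-split₂ p q a b))) c))

    ProductDeterminesOrderAtSharedVertices : Edges n → Set
    ProductDeterminesOrderAtSharedVertices E =
      ∀ {e f} → e ∈ E → f ∈ E → e ≢ f → Share e f → ∀ {w w′} → w ↭ E → w′ ↭ E →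
      (∀ z → prodFun w z ≡ prodFun w′ z) → filter (oneOf? _≟e_ e f) w ≡ filter (oneOf? _≟e_ e f) w′

    module _ (E : Edges n) (unique-E : Unique E) (determined : ProductDeterminesOrderAtSharedVertices E) where

      private
        sameProduct? : (w w′ : Edges n) → Dec (prodPerm w′ ≡ prodPerm w)
        sameProduct? w w′ = Vecₚ.≡-dec _≟_ (prodPerm w′) (prodPerm w)

        prodPerm⇒prodFun : ∀ {w w′ : Edges n} → prodPerm w ≡ prodPerm w′ → ∀ z → prodFun w z ≡ prodFun w′ z
        prodPerm⇒prodFun {w} {w′} eq z =
          trans (sym (Vecₚ.lookup∘tabulate (prodFun w) z))
                (trans (cong (λ σ → lookup σ z) eq) (Vecₚ.lookup∘tabulate (prodFun w′) z))

      chain⇒only-ordering : ∀ {w w′} → w ∈ orderings E → Chain w → w′ ∈ orderings E → prodPerm w′ ≡ prodPerm w → w′ ≡ w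
      chain⇒only-ordering {w} {w′} w∈ chain w′∈ same =
        consecutive-order⇒≡ _≟e_ w w′ unique-w (↭-trans (orderings-↭ E w′∈) (↭-sym (orderings-↭ E w∈))) ordered
        where
        unique-w = unique-resp-↭ unique-E (↭-sym (orderings-↭ E w∈))
        ordered : ∀ p g h q → w ≡ p ++ g ∷ h ∷ q → filter (oneOf? _≟e_ g h) w′ ≡ g ∷ h ∷ []
        ordered p g h q refl =
          trans (sym (determined g∈ h∈ g≢h (chain-split⁻ p q chain) (orderings-↭ E w∈) (orderings-↭ E w′∈)
                        (prodPerm⇒prodFun {w} {w′} (sym same))))
                (unique⇒filter-oneOf _≟e_ p g [] h q unique-w)
          where
          g∈ = ↭.∈-resp-↭ (orderings-↭ E w∈) (∈-++⁺ʳ p (here refl))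
          h∈ = ↭.∈-resp-↭ (orderings-↭ E w∈) (∈-++⁺ʳ p (there (here refl)))
          g≢h : g ≢ h
          g≢h g≡h = proj₂ (unique-∉-split p unique-w) (here g≡h)

      chain⇒multiplicityOne : ∀ {w} → w ∈ orderings E → Chain w → multiplicity E (prodPerm w) ≡ 1
      chain⇒multiplicityOne {w} w∈ chain =
        unique-constant⇒length≡1 (filter (sameProduct? w) (orderings E))
          (Unique.filter⁺ (sameProduct? w) (unique-orderings E unique-E)) (∈-filter⁺ (sameProduct? w) w∈ refl)
          (λ w′∈ → let (w′∈o , same) = ∈-filter⁻ (sameProduct? w) {xs = orderings E} w′∈ in
                   chain⇒only-ordering w∈ chain w′∈o same)

      -- A non-chain has two adjacent disjoint edges; swapping them keeps the product.
      multiplicityOne⇒chain : ∀ {w} → w ∈ orderings E → multiplicity E (prodPerm w) ≡ 1 → Chain w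
      multiplicityOne⇒chain {w} w∈ mult≡1 with chain? w
      ... | yes chain = chain
      ... | no ¬chain with ¬chain⇒split w ¬chain
      ... | p , g , h , q , refl , ¬share =
        ⊥-elim (w≢w′ (length≡1⇒≡ mult≡1 (∈-filter⁺ (sameProduct? w) w∈ refl) (∈-filter⁺ (sameProduct? w) w′∈ (sym same))))
        where
        w′ = p ++ h ∷ g ∷ q
        w′∈ : w′ ∈ orderings E
        w′∈ = ↭⇒∈-orderings E (↭-trans (↭.++⁺ˡ p (↭-swap h g ↭-refl)) (orderings-↭ E w∈))
        same : prodPerm w ≡ prodPerm w′
        same = Vecₚ.tabulate-cong {f = prodFun (p ++ g ∷ h ∷ q)} {g = prodFun w′} (prodFun-swap-disjoint p q g h ¬share)
        w≢w′ : w ≢ w′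
        w≢w′ eq = ¬share (subst (Share g) (proj₁ (∷-injective (++-cancelˡ p (g ∷ h ∷ q) (h ∷ g ∷ q) eq)))
                            (proj₁ g , inj₁ refl , inj₁ refl))

      numMultOne≡#chains : numMultOne E ≡ length (filter chain? (orderings E))
      numMultOne≡#chains = trans (numMultOne≡#orderingsOfMultiplicityOne E unique-E)
        (unique-sameElements⇒length≡ (Unique.filter⁺ (hasMultiplicityOne? E) (unique-orderings E unique-E))
                                     (Unique.filter⁺ chain? (unique-orderings E unique-E))
          (λ w∈ → let (w∈o , mult≡1) = ∈-filter⁻ (hasMultiplicityOne? E) {xs = orderings E} w∈ in
                  ∈-filter⁺ chain? w∈o (multiplicityOne⇒chain w∈o mult≡1))
          (λ w∈ → let (w∈o , chain) = ∈-filter⁻ chain? {xs = orderings E} w∈ in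
                  ∈-filter⁺ (hasMultiplicityOne? E) w∈o (chain⇒multiplicityOne w∈o chain)))

module BlockOrderings where

  open import Data.Nat using (ℕ; zero; suc; _+_; _*_; _≤_; _<_; _!; _≤?_; _<?_)
  import Data.Nat.Properties as ℕₚ
  open import Data.Nat.ListAction using (product)
  open import Data.Fin using (Fin; zero; suc; toℕ)
  open import Data.List using (List; []; _∷_; _++_; map; concatMap; filter; length; allFin; tabulate)
  open import Data.List.Properties
    using (filter-accept; filter-reject; filter-++; filter-all; filter-none; length-map; map-tabulate; ∷-injective; ++-cancelˡ; ++-identityʳ)
  open import Data.List.Membership.Propositional using (_∈_; _∉_)
  open import Data.List.Membership.Propositional.Properties using (∈-map⁺; ∈-map⁻; ∈-++⁺ˡ; ∈-++⁺ʳ; ∈-++⁻)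
  open import Data.List.Relation.Unary.Any using (here; there)
  open import Data.List.Relation.Unary.All using (All; []; _∷_)
  import Data.List.Relation.Unary.All as All
  import Data.List.Relation.Unary.All.Properties as All
  open import Data.List.Relation.Unary.AllPairs using (AllPairs; []; _∷_)
  import Data.List.Relation.Unary.AllPairs.Properties as AllPairs
  open import Data.List.Relation.Unary.Unique.Propositional using (Unique)
  import Data.List.Relation.Unary.Unique.Propositional.Properties as Unique
  open import Data.List.Relation.Binary.Permutation.Propositional using (_↭_; ↭-sym; ↭-prep)
  import Data.List.Relation.Binary.Permutation.Propositional.Properties as ↭
  open import Data.Product using (_×_; _,_; proj₁; proj₂; ∃)
  open import Data.Sum using (_⊎_; inj₁; inj₂)
  open import Data.Empty using (⊥; ⊥-elim)
  open import Function using (_∘_; id)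
  open import Relation.Binary.PropositionalEquality using (_≡_; _≢_; refl; sym; trans; cong; cong₂; subst; module ≡-Reasoning)
  open import Relation.Nullary using (¬_; Dec; yes; no)
  open import Defs using (orderings)
  open ListFacts
  open Orderings

  module _ {A : Set} (key : A → ℕ) where

    Sorted : List A → Set
    Sorted = AllPairs (λ a b → key a ≤ key b)

    constant⇒sorted : ∀ {c} {xs : List A} → All (λ x → key x ≡ c) xs → Sorted xs
    constant⇒sorted [] = []
    constant⇒sorted (kx ∷ kxs) = All.map (λ ky → ℕₚ.≤-reflexive (trans kx (sym ky))) kxs ∷ constant⇒sorted kxs

    sorted-++ : ∀ {t} {xs ys : List A} → Sorted xs → Sorted ys →
      All (λ x → key x ≤ t) xs → All (λ y → t ≤ key y) ys → Sorted (xs ++ ys)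
    sorted-++ sxs sys xs≤t t≤ys =
      AllPairs.++⁺ sxs sys (All.map (λ x≤t → All.map (ℕₚ.≤-trans x≤t) t≤ys) xs≤t)

    sorted-split : ∀ t (u : List A) → Sorted u →
      u ≡ filter (λ x → key x ≤? t) u ++ filter (λ x → t <? key x) u
    sorted-split t [] _ = refl
    sorted-split t (x ∷ u) (x≤u ∷ su) = by-cases (key x ≤? t)
      where
      low? = λ y → key y ≤? t
      high? = λ y → t <? key y
      by-cases : Dec (key x ≤ t) → x ∷ u ≡ filter low? (x ∷ u) ++ filter high? (x ∷ u)
      by-cases (yes x≤t) = trans (cong (x ∷_) (sorted-split t u su))
        (sym (cong₂ _++_ (filter-accept low? x≤t) (filter-reject high? (ℕₚ.≤⇒≯ x≤t))))
      by-cases (no x≰t) = begin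
        x ∷ u                                 ≡⟨ cong (x ∷_) (sym (filter-all high? t<u)) ⟩
        x ∷ filter high? u                    ≡⟨ cong (_++ x ∷ filter high? u) (sym (filter-none low? u≰t)) ⟩
        filter low? u ++ x ∷ filter high? u   ≡⟨ sym (cong₂ _++_ (filter-reject low? x≰t) (filter-accept high? (ℕₚ.≰⇒> x≰t))) ⟩
        filter low? (x ∷ u) ++ filter high? (x ∷ u) ∎
        where
        open ≡-Reasoning
        t<u : All (λ y → t < key y) u
        t<u = All.map (ℕₚ.<-≤-trans (ℕₚ.≰⇒> x≰t)) x≤u
        u≰t : All (λ y → ¬ key y ≤ t) u
        u≰t = All.map ℕₚ.<⇒≱ t<u

    sorted-↭-minimum : ∀ {x} {F q : List A} → q ↭ x ∷ F → Sorted q → All (λ y → key x < key y) F →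
      ∃ λ r → q ≡ x ∷ r × r ↭ F
    sorted-↭-minimum {q = []} q↭ _ _ with ↭.↭-length q↭
    ... | ()
    sorted-↭-minimum {q = y ∷ r} q↭ (y≤r ∷ _) x<F with ↭.∈-resp-↭ q↭ (here refl)
    ... | here refl = r , refl , ↭.drop-∷ q↭
    ... | there y∈F with ↭.∈-resp-↭ (↭-sym q↭) (here refl)
    ...   | here x≡y = ⊥-elim (ℕₚ.<-irrefl (cong key x≡y) (All.lookup x<F y∈F))
    ...   | there x∈r = ⊥-elim (ℕₚ.<⇒≱ (All.lookup x<F y∈F) (All.lookup y≤r x∈r))

    concatBlocks : ∀ m → (Fin (suc m) → List A) → (Fin m → A) → List A
    concatBlocks zero L S = L zero
    concatBlocks (suc m) L S = L zero ++ S zero ∷ concatBlocks m (L ∘ suc) (S ∘ suc)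

    blockOrderings : ∀ m → (Fin (suc m) → List A) → (Fin m → A) → List (List A)
    blockOrderings zero L S = orderings (L zero)
    blockOrderings (suc m) L S =
      concatMap (λ π → map (λ ρ → π ++ S zero ∷ ρ) (blockOrderings m (L ∘ suc) (S ∘ suc))) (orderings (L zero))

    KeyLayout : ℕ → ∀ m → (Fin (suc m) → List A) → (Fin m → A) → Set
    KeyLayout b zero L S = All (λ x → key x ≡ b) (L zero)
    KeyLayout b (suc m) L S =
      All (λ x → key x ≡ b) (L zero) × key (S zero) ≡ suc b × KeyLayout (2 + b) m (L ∘ suc) (S ∘ suc)

    keyLayout : ∀ b m L S → (∀ i {x} → x ∈ L i → key x ≡ b + 2 * toℕ i) → (∀ i → key (S i) ≡ suc (b + 2 * toℕ i)) →
      KeyLayout b m L S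
    keyLayout b zero L S keyL keyS = All.tabulate (λ x∈ → trans (keyL zero x∈) (ℕₚ.+-identityʳ b))
    keyLayout b (suc m) L S keyL keyS =
      All.tabulate (λ x∈ → trans (keyL zero x∈) (ℕₚ.+-identityʳ b)) ,
      trans (keyS zero) (cong suc (ℕₚ.+-identityʳ b)) ,
      keyLayout (2 + b) m (L ∘ suc) (S ∘ suc) (λ i x∈ → trans (keyL (suc i) x∈) (shift (toℕ i)))
                                              (λ i → trans (keyS (suc i)) (cong suc (shift (toℕ i))))
      where
      shift : ∀ t → b + 2 * suc t ≡ 2 + b + 2 * t
      shift t = trans (cong (b +_) (ℕₚ.*-suc 2 t)) (trans (sym (ℕₚ.+-assoc b 2 (2 * t))) (cong (_+ 2 * t) (ℕₚ.+-comm b 2)))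

    constant-key : ∀ {b} {xs ys : List A} → All (λ x → key x ≡ b) xs → ys ↭ xs → All (λ y → key y ≡ b) ys
    constant-key kxs ys↭xs = All.tabulate (All.lookup kxs ∘ ↭.∈-resp-↭ ys↭xs)

    concatBlocks-key≥ : ∀ b m L S → KeyLayout b m L S → All (λ x → b ≤ key x) (concatBlocks m L S)
    concatBlocks-key≥ b zero L S kL = All.map (ℕₚ.≤-reflexive ∘ sym) kL
    concatBlocks-key≥ b (suc m) L S (kL , kS , layout) =
      All.++⁺ (All.map (ℕₚ.≤-reflexive ∘ sym) kL)
              (ℕₚ.≤-trans (ℕₚ.n≤1+n b) (ℕₚ.≤-reflexive (sym kS)) ∷
               All.map (ℕₚ.≤-trans (ℕₚ.≤-trans (ℕₚ.n≤1+n b) (ℕₚ.n≤1+n (suc b)))) (concatBlocks-key≥ (2 + b) m (L ∘ suc) (S ∘ suc) layout))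

    blockOrderings-↭ : ∀ m L S {u} → u ∈ blockOrderings m L S → u ↭ concatBlocks m L S
    blockOrderings-↭ zero L S u∈ = orderings-↭ (L zero) u∈
    blockOrderings-↭ (suc m) L S u∈ with ∈-concatMap⁻′ _ (orderings (L zero)) u∈
    ... | π , π∈ , u∈′ with ∈-map⁻ _ u∈′
    ... | ρ , ρ∈ , refl = ↭.++⁺ (orderings-↭ (L zero) π∈) (↭-prep (S zero) (blockOrderings-↭ m (L ∘ suc) (S ∘ suc) ρ∈))

    blockOrderings-sorted : ∀ b m L S → KeyLayout b m L S → ∀ {u} → u ∈ blockOrderings m L S → Sorted u
    blockOrderings-sorted b zero L S kL u∈ = constant⇒sorted (constant-key kL (orderings-↭ (L zero) u∈))
    blockOrderings-sorted b (suc m) L S (kL , kS , layout) u∈ with ∈-concatMap⁻′ _ (orderings (L zero)) u∈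
    ... | π , π∈ , u∈′ with ∈-map⁻ _ u∈′
    ... | ρ , ρ∈ , refl =
      sorted-++ {t = suc b} (constant⇒sorted kπ)
        (All.map (ℕₚ.≤-trans (ℕₚ.≤-reflexive kS) ∘ ℕₚ.<⇒≤) ρ≥ ∷ blockOrderings-sorted (2 + b) m (L ∘ suc) (S ∘ suc) layout ρ∈)
        (All.map (λ kx → ℕₚ.≤-trans (ℕₚ.≤-reflexive kx) (ℕₚ.n≤1+n b)) kπ)
        (ℕₚ.≤-reflexive (sym kS) ∷ All.map (ℕₚ.≤-trans (ℕₚ.n≤1+n (suc b))) ρ≥)
      where
      kπ = constant-key kL (orderings-↭ (L zero) π∈)
      ρ≥ : All (λ y → 2 + b ≤ key y) ρ
      ρ≥ = All.tabulate (All.lookup (concatBlocks-key≥ (2 + b) m (L ∘ suc) (S ∘ suc) layout)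
                         ∘ ↭.∈-resp-↭ (blockOrderings-↭ m (L ∘ suc) (S ∘ suc) ρ∈))

    sorted⇒∈-blockOrderings : ∀ b m L S → KeyLayout b m L S → ∀ {u} → u ↭ concatBlocks m L S → Sorted u →
      u ∈ blockOrderings m L S
    sorted⇒∈-blockOrderings b zero L S _ u↭ _ = ↭⇒∈-orderings (L zero) u↭
    sorted⇒∈-blockOrderings b (suc m) L S (kL , kS , layout) {u} u↭ su =
      from-head (sorted-↭-minimum (subst (filter high? u ↭_) high-part (↭.filter-↭ high? u↭)) (AllPairs.filter⁺ high? su) S<F)
      where
      F = concatBlocks m (L ∘ suc) (S ∘ suc)
      low? = λ y → key y ≤? b
      high? = λ y → b <? key y
      F≥ = concatBlocks-key≥ (2 + b) m (L ∘ suc) (S ∘ suc) layout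
      S<F : All (λ y → key (S zero) < key y) F
      S<F = All.map (ℕₚ.<-≤-trans (ℕₚ.≤-reflexive (cong suc kS))) F≥
      low-part : filter low? (L zero ++ S zero ∷ F) ≡ L zero
      low-part = begin
        filter low? (L zero ++ S zero ∷ F)                 ≡⟨ filter-++ low? (L zero) (S zero ∷ F) ⟩
        filter low? (L zero) ++ filter low? (S zero ∷ F)   ≡⟨ cong₂ _++_ (filter-all low? (All.map (ℕₚ.≤-reflexive) kL))
                                                                         (trans (filter-reject low? (ℕₚ.<⇒≱ (ℕₚ.≤-reflexive (sym kS))))
                                                                                (filter-none low? (All.map (ℕₚ.<⇒≱ ∘ ℕₚ.≤-trans (ℕₚ.n≤1+n (suc b))) F≥))) ⟩
        L zero ++ []                                       ≡⟨ ++-identityʳ (L zero) ⟩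
        L zero                                             ∎
        where open ≡-Reasoning
      high-part : filter high? (L zero ++ S zero ∷ F) ≡ S zero ∷ F
      high-part = begin
        filter high? (L zero ++ S zero ∷ F)                 ≡⟨ filter-++ high? (L zero) (S zero ∷ F) ⟩
        filter high? (L zero) ++ filter high? (S zero ∷ F)  ≡⟨ cong₂ _++_ (filter-none high? (All.map (λ kx → ℕₚ.<-irrefl (sym kx)) kL))
                                                                          (filter-accept high? (ℕₚ.≤-reflexive (sym kS))) ⟩
        S zero ∷ filter high? F                             ≡⟨ cong (S zero ∷_) (filter-all high? (All.map (ℕₚ.≤-trans (ℕₚ.n≤1+n (suc b))) F≥)) ⟩
        S zero ∷ F                                          ∎
        where open ≡-Reasoning
      from-head : (∃ λ ρ → filter high? u ≡ S zero ∷ ρ × ρ ↭ F) → u ∈ blockOrderings (suc m) L S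
      from-head (ρ , high≡ , ρ↭) =
        subst (_∈ blockOrderings (suc m) L S) (sym (trans (sorted-split b u su) (cong (filter low? u ++_) high≡)))
          (∈-concatMap⁺′ _ (↭⇒∈-orderings (L zero) (subst (filter low? u ↭_) low-part (↭.filter-↭ low? u↭)))
            (∈-map⁺ _ (sorted⇒∈-blockOrderings (2 + b) m (L ∘ suc) (S ∘ suc) layout ρ↭
                         (tail-sorted (subst Sorted high≡ (AllPairs.filter⁺ high? su))))))
        where
        tail-sorted : ∀ {x xs} → Sorted (x ∷ xs) → Sorted xs
        tail-sorted (_ ∷ s) = s

    length-blockOrderings : ∀ m L S → length (blockOrderings m L S) ≡ product (map (λ i → length (L i) !) (allFin (suc m)))
    length-blockOrderings zero L S = trans (length-orderings (L zero)) (sym (ℕₚ.*-identityʳ _))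
    length-blockOrderings (suc m) L S = begin
      length (blockOrderings (suc m) L S)
        ≡⟨ length-concatMap-const _ (length (blockOrderings m (L ∘ suc) (S ∘ suc))) (orderings (L zero))
             (λ _ → length-map _ (blockOrderings m (L ∘ suc) (S ∘ suc))) ⟩
      length (orderings (L zero)) * length (blockOrderings m (L ∘ suc) (S ∘ suc))
        ≡⟨ cong₂ _*_ (length-orderings (L zero)) (length-blockOrderings m (L ∘ suc) (S ∘ suc)) ⟩
      length (L zero) ! * product (map (λ i → length (L (suc i)) !) (allFin (suc m)))
        ≡⟨ cong product (sym (map-allFin-suc (suc m) (λ i → length (L i) !))) ⟩
      product (map (λ i → length (L i) !) (allFin (suc (suc m)))) ∎
      where
      open ≡-Reasoning
      map-allFin-suc : ∀ {B : Set} k (f : Fin (suc k) → B) → map f (allFin (suc k)) ≡ f zero ∷ map (f ∘ suc) (allFin k)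
      map-allFin-suc k f = cong (f zero ∷_) (trans (map-tabulate suc f) (sym (map-tabulate id (f ∘ suc))))

    ∈-concatBlocks⁻ : ∀ m L S {x} → x ∈ concatBlocks m L S → (∃ λ i → x ∈ L i) ⊎ (∃ λ i → x ≡ S i)
    ∈-concatBlocks⁻ zero L S x∈ = inj₁ (zero , x∈)
    ∈-concatBlocks⁻ (suc m) L S x∈ with ∈-++⁻ (L zero) x∈
    ... | inj₁ x∈L = inj₁ (zero , x∈L)
    ... | inj₂ (here x≡S) = inj₂ (zero , x≡S)
    ... | inj₂ (there x∈F) with ∈-concatBlocks⁻ m (L ∘ suc) (S ∘ suc) x∈F
    ...   | inj₁ (i , x∈L) = inj₁ (suc i , x∈L)
    ...   | inj₂ (i , x≡S) = inj₂ (suc i , x≡S)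

    ∈-concatBlocks⁺ˡ : ∀ m L S i {x} → x ∈ L i → x ∈ concatBlocks m L S
    ∈-concatBlocks⁺ˡ zero L S zero x∈ = x∈
    ∈-concatBlocks⁺ˡ (suc m) L S zero x∈ = ∈-++⁺ˡ x∈
    ∈-concatBlocks⁺ˡ (suc m) L S (suc i) x∈ = ∈-++⁺ʳ (L zero) (there (∈-concatBlocks⁺ˡ m (L ∘ suc) (S ∘ suc) i x∈))

    ∈-concatBlocks⁺ʳ : ∀ m L S i → S i ∈ concatBlocks m L S
    ∈-concatBlocks⁺ʳ (suc m) L S zero = ∈-++⁺ʳ (L zero) (here refl)
    ∈-concatBlocks⁺ʳ (suc m) L S (suc i) = ∈-++⁺ʳ (L zero) (there (∈-concatBlocks⁺ʳ m (L ∘ suc) (S ∘ suc) i))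

    unique-concatBlocks : ∀ b m L S → KeyLayout b m L S → (∀ i → Unique (L i)) → Unique (concatBlocks m L S)
    unique-concatBlocks b zero L S _ uL = uL zero
    unique-concatBlocks b (suc m) L S (kL , kS , layout) uL =
      Unique.++⁺ (uL zero) (All.map S≢ F≥ ∷ unique-concatBlocks (2 + b) m (L ∘ suc) (S ∘ suc) layout (uL ∘ suc)) disjoint
      where
      F = concatBlocks m (L ∘ suc) (S ∘ suc)
      F≥ = concatBlocks-key≥ (2 + b) m (L ∘ suc) (S ∘ suc) layout
      S≢ : ∀ {y} → 2 + b ≤ key y → S zero ≢ y
      S≢ b+2≤ refl = ℕₚ.<-irrefl (sym kS) b+2≤
      disjoint : ∀ {x} → x ∈ L zero × x ∈ S zero ∷ F → ⊥
      disjoint (x∈L , here refl) = ℕₚ.<-irrefl (trans (sym (All.lookup kL x∈L)) kS) (ℕₚ.n<1+n b)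
      disjoint {x} (x∈L , there x∈F) =
        ℕₚ.<-irrefl refl (ℕₚ.≤-trans (ℕₚ.n≤1+n (suc (key x))) (subst (λ c → 2 + c ≤ key x) (sym (All.lookup kL x∈L)) (All.lookup F≥ x∈F)))

    unique-blockOrderings : ∀ m L S → Unique (concatBlocks m L S) → Unique (blockOrderings m L S)
    unique-blockOrderings zero L S u = unique-orderings (L zero) u
    unique-blockOrderings (suc m) L S u =
      unique-concatMap _ (orderings (L zero)) (unique-orderings (L zero) (unique-++⁻ˡ (L zero) u))
        (λ _ → Unique.map⁺ (proj₂ ∘ ∷-injective ∘ ++-cancelˡ _ _ _)
                 (unique-blockOrderings m (L ∘ suc) (S ∘ suc) (tail (unique-++⁻ʳ (L zero) u))))
        same-prefix
      where
      tail : ∀ {x xs} → Unique (x ∷ xs) → Unique xs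
      tail (_ ∷ u) = u
      S∉ : ∀ {π} → π ∈ orderings (L zero) → S zero ∉ π
      S∉ π∈ = proj₁ (unique-∉-split (L zero) u) ∘ ↭.∈-resp-↭ (orderings-↭ (L zero) π∈)
      same-prefix : ∀ {π π′ w} → π ∈ orderings (L zero) → π′ ∈ orderings (L zero) →
        w ∈ map (λ ρ → π ++ S zero ∷ ρ) (blockOrderings m (L ∘ suc) (S ∘ suc)) →
        w ∈ map (λ ρ → π′ ++ S zero ∷ ρ) (blockOrderings m (L ∘ suc) (S ∘ suc)) → π ≡ π′
      same-prefix π∈ π′∈ w∈ w∈′ with ∈-map⁻ _ w∈ | ∈-map⁻ _ w∈′
      ... | ρ , _ , refl | ρ′ , _ , eq = proj₁ (split-injective _ ρ _ ρ′ eq (S∉ π∈) (S∉ π′∈))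

module CaterpillarEdges where

  open import Data.Nat using (ℕ; suc; _+_; _*_; _≤_; _<_; _⊓_; s≤s)
  import Data.Nat as ℕ
  import Data.Nat.Properties as ℕₚ
  open import Data.Fin using (Fin; zero; suc; _≟_; inject₁; toℕ)
  import Data.Fin.Properties as Fₚ
  open import Data.List using (length; lookup)
  open import Data.List.Membership.Propositional using (_∈_; _∉_)
  open import Data.List.Membership.Propositional.Properties using (∈-filter⁻; ∈-lookup)
  open import Data.List.Relation.Unary.Any using (index)
  open import Data.List.Relation.Unary.Any.Properties using (lookup-index)
  open import Data.List.Relation.Unary.Unique.Propositional using (Unique)
  open import Data.Product using (_×_; _,_; proj₁; proj₂; ∃; swap)
  open import Data.Sum using (_⊎_; inj₁; inj₂)
  open import Data.Empty using (⊥; ⊥-elim)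
  open import Function using (_∘_)
  open import Relation.Binary.PropositionalEquality using (_≡_; _≢_; refl; sym; trans; cong; cong₂; subst)
  open import Relation.Nullary using (¬_; Dec; yes; no)
  open import Defs
  open ListFacts
  open Transpositions

  module Caterpillar {n k : ℕ} (E : Edges n) (v : Fin (suc k) → Fin n) (C : IsCaterpillarWithBody E v) where
    open IsCaterpillarWithBody C public

    Leaf : Fin n → Set
    Leaf = IsLeaf E

    leaf? : (u : Fin n) → Dec (Leaf u)
    leaf? u = deg E u ℕ.≟ 1

    edgeAt : Fin (length E) → Fin n × Fin n
    edgeAt = lookup E

    edgeAt-index : ∀ {g} (g∈ : g ∈ E) → edgeAt (index g∈) ≡ g
    edgeAt-index g∈ = sym (lookup-index g∈)

    leaf-incident-unique : ∀ {u} → Leaf u → ∀ p q → Incident u (edgeAt p) → Incident u (edgeAt q) → p ≡ q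
    leaf-incident-unique {u} leaf p q inc-p inc-q with p ≟ q
    ... | yes p≡q = p≡q
    ... | no p≢q with subst (2 ≤_) leaf (filter-length≥2 (incident? u) E p≢q inc-p inc-q)
    ...   | s≤s ()

    leaf-incident : ∀ {u} → Leaf u → ∃ λ p → Incident u (edgeAt p)
    leaf-incident {u} leaf with length≡1⇒∈ leaf
    ... | g , g∈ with ∈-filter⁻ (incident? u) {xs = E} g∈
    ... | g∈E , inc = index g∈E , subst (Incident u) (sym (edgeAt-index g∈E)) inc

    leaf-edge-unique : ∀ {u g h} → Leaf u → g ∈ E → h ∈ E → Incident u g → Incident u h → g ≡ h
    leaf-edge-unique {u} leaf g∈ h∈ inc-g inc-h =
      trans (sym (edgeAt-index g∈))
        (trans (cong edgeAt (leaf-incident-unique leaf (index g∈) (index h∈)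
                  (subst (Incident u) (sym (edgeAt-index g∈)) inc-g) (subst (Incident u) (sym (edgeAt-index h∈)) inc-h)))
          (edgeAt-index h∈))

    -- An edge between two leaves would be a whole component, missing the body.
    no-edge-between-leaves : ∀ p → Leaf (proj₁ (edgeAt p)) → Leaf (proj₂ (edgeAt p)) → ⊥
    no-edge-between-leaves p leaf₁ leaf₂ = bodyNoLeaf zero (leaf-end (closed (proj₁ tree _ (v zero)) (inj₁ refl)))
      where
      End : Fin n → Set
      End x = Incident x (edgeAt p)
      leaf-end : ∀ {x} → End x → Leaf x
      leaf-end (inj₁ refl) = leaf₁
      leaf-end (inj₂ refl) = leaf₂
      step-end : ∀ {x z} → End x → Adj E x z → End z
      step-end {x} end (inj₁ xz∈) =
        inj₂ (cong proj₂ (trans (cong edgeAt (sym (leaf-incident-unique (leaf-end end) (index xz∈) p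
          (subst (Incident x) (sym (edgeAt-index xz∈)) (inj₁ refl)) end))) (edgeAt-index xz∈)))
      step-end {x} end (inj₂ zx∈) =
        inj₁ (cong proj₁ (trans (cong edgeAt (sym (leaf-incident-unique (leaf-end end) (index zx∈) p
          (subst (Incident x) (sym (edgeAt-index zx∈)) (inj₂ refl)) end))) (edgeAt-index zx∈)))
      closed : ∀ {x y} → Reach E x y → End x → End y
      closed here end = end
      closed (step adj r) end = closed r (step-end end adj)

    BodyEdge : Fin k → Fin n × Fin n → Set
    BodyEdge i = Joins (v (inject₁ i)) (v (suc i))

    bodyPos : Fin k → Fin (length E)
    bodyPos i with path i
    ... | inj₁ g∈ = index g∈
    ... | inj₂ g∈ = index g∈

    bodyEdge : Fin k → Fin n × Fin n
    bodyEdge i = edgeAt (bodyPos i)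

    bodyEdge∈E : ∀ i → bodyEdge i ∈ E
    bodyEdge∈E i = ∈-lookup (bodyPos i)

    bodyEdge-isBodyEdge : ∀ i → BodyEdge i (bodyEdge i)
    bodyEdge-isBodyEdge i with path i
    ... | inj₁ g∈ = inj₁ (edgeAt-index g∈)
    ... | inj₂ g∈ = inj₂ (edgeAt-index g∈)

    Inner : Fin n × Fin n → Set
    Inner g = ¬ Leaf (proj₁ g) × ¬ Leaf (proj₂ g)

    bodyEdge-inner : ∀ {i g} → BodyEdge i g → Inner g
    bodyEdge-inner {i} (inj₁ refl) = bodyNoLeaf (inject₁ i) , bodyNoLeaf (suc i)
    bodyEdge-inner {i} (inj₂ refl) = bodyNoLeaf (suc i) , bodyNoLeaf (inject₁ i)

    inner-¬incident-leaf : ∀ {g x} → Inner g → Leaf x → ¬ Incident x g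
    inner-¬incident-leaf (¬leaf₁ , _) leaf (inj₁ refl) = ¬leaf₁ leaf
    inner-¬incident-leaf (_ , ¬leaf₂) leaf (inj₂ refl) = ¬leaf₂ leaf

    private
      inject₁≢suc : ∀ {i : Fin k} → inject₁ i ≢ suc i
      inject₁≢suc {i} eq = ℕₚ.1+n≢n (sym (trans (sym (Fₚ.toℕ-inject₁ i)) (cong toℕ eq)))

      crossed : ∀ {i i′ : Fin k} → inject₁ i ≡ suc i′ → Fin.suc i ≡ inject₁ i′ → ⊥
      crossed {i} {i′} i≡i′+1 i+1≡i′ = ℕₚ.<-irrefl refl (subst (toℕ i′ <_) i′+2≡i′ (s≤s (ℕₚ.n≤1+n _)))
        where
        i′+2≡i′ : suc (suc (toℕ i′)) ≡ toℕ i′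
        i′+2≡i′ = trans (cong suc (trans (sym (cong toℕ i≡i′+1)) (Fₚ.toℕ-inject₁ i)))
                        (trans (cong toℕ i+1≡i′) (Fₚ.toℕ-inject₁ i′))

    isBodyEdge-injective : ∀ {i i′ g} → BodyEdge i g → BodyEdge i′ g → i ≡ i′
    isBodyEdge-injective (inj₁ refl) (inj₁ eq) = Fₚ.inject₁-injective (injective _ _ (cong proj₁ eq))
    isBodyEdge-injective (inj₁ refl) (inj₂ eq) = ⊥-elim (crossed (injective _ _ (cong proj₁ eq)) (injective _ _ (cong proj₂ eq)))
    isBodyEdge-injective (inj₂ refl) (inj₁ eq) = ⊥-elim (crossed (injective _ _ (cong proj₂ eq)) (injective _ _ (cong proj₁ eq)))
    isBodyEdge-injective (inj₂ refl) (inj₂ eq) = Fₚ.inject₁-injective (injective _ _ (cong proj₂ eq))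

    bodyPos-injective : ∀ {i i′} → bodyPos i ≡ bodyPos i′ → i ≡ i′
    bodyPos-injective {i} {i′} eq =
      isBodyEdge-injective (bodyEdge-isBodyEdge i) (subst (BodyEdge i′) (cong edgeAt (sym eq)) (bodyEdge-isBodyEdge i′))

    -- Otherwise the vertices could be sent injectively to edges: a leaf to its edge, v 0 to p and
    -- v (suc i) to body edge i; but a tree has fewer edges than vertices.
    inner⇒body : ∀ p → Inner (edgeAt p) → ∃ λ i → p ≡ bodyPos i
    inner⇒body p inner with Fₚ.any? (λ i → p ≟ bodyPos i)
    ... | yes body = body
    ... | no ¬body = ⊥-elim collision
      where
      Assigned : Fin n → Fin (length E) → Set
      Assigned x q = Leaf x × Incident x (edgeAt q)
                   ⊎ ∃ λ j → v j ≡ x × (j ≡ zero × q ≡ p ⊎ ∃ λ i → j ≡ suc i × q ≡ bodyPos i)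
      assign : ∀ x → ∃ (Assigned x)
      assign x with leaf? x
      ... | yes leaf = proj₁ (leaf-incident leaf) , inj₁ (leaf , proj₂ (leaf-incident leaf))
      ... | no ¬leaf with body x ¬leaf
      ...   | zero , vj≡x = p , inj₂ (zero , vj≡x , inj₁ (refl , refl))
      ...   | suc i , vj≡x = bodyPos i , inj₂ (suc i , vj≡x , inj₂ (i , refl , refl))
      assigned-inner : ∀ {j q} → Assigned (v j) q → Inner (edgeAt q)
      assigned-inner {j} (inj₁ (leaf , _)) = ⊥-elim (bodyNoLeaf j leaf)
      assigned-inner (inj₂ (_ , _ , inj₁ (_ , refl))) = inner
      assigned-inner (inj₂ (_ , _ , inj₂ (i , _ , refl))) = bodyEdge-inner (bodyEdge-isBodyEdge i)
      assigned-injective : ∀ {x y q} → Assigned x q → Assigned y q → x ≡ y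
      assigned-injective {q = q} (inj₁ (leaf-x , inj₁ refl)) (inj₁ (leaf-y , inj₁ refl)) = refl
      assigned-injective {q = q} (inj₁ (leaf-x , inj₁ refl)) (inj₁ (leaf-y , inj₂ refl)) = ⊥-elim (no-edge-between-leaves q leaf-x leaf-y)
      assigned-injective {q = q} (inj₁ (leaf-x , inj₂ refl)) (inj₁ (leaf-y , inj₁ refl)) = ⊥-elim (no-edge-between-leaves q leaf-y leaf-x)
      assigned-injective {q = q} (inj₁ (leaf-x , inj₂ refl)) (inj₁ (leaf-y , inj₂ refl)) = refl
      assigned-injective (inj₁ (leaf , inc)) a@(inj₂ (j , refl , _)) = ⊥-elim (inner-¬incident-leaf (assigned-inner a) leaf inc)
      assigned-injective a@(inj₂ (j , refl , _)) (inj₁ (leaf , inc)) = ⊥-elim (inner-¬incident-leaf (assigned-inner a) leaf inc)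
      assigned-injective (inj₂ (_ , refl , inj₁ (refl , _))) (inj₂ (_ , refl , inj₁ (refl , _))) = refl
      assigned-injective (inj₂ (_ , refl , inj₁ (_ , refl))) (inj₂ (_ , refl , inj₂ (i , _ , q≡))) = ⊥-elim (¬body (i , q≡))
      assigned-injective (inj₂ (_ , refl , inj₂ (i , _ , q≡))) (inj₂ (_ , refl , inj₁ (_ , refl))) = ⊥-elim (¬body (i , q≡))
      assigned-injective (inj₂ (_ , refl , inj₂ (i , refl , refl))) (inj₂ (_ , refl , inj₂ (i′ , refl , same))) =
        cong (v ∘ suc) (bodyPos-injective same)
      collision : ⊥
      collision with Fₚ.pigeonhole (ℕₚ.≤-reflexive (proj₂ tree)) (proj₁ ∘ assign)
      ... | x , y , x<y , same =
        Fₚ.<⇒≢ x<y (assigned-injective (proj₂ (assign x)) (subst (Assigned y) (sym same) (proj₂ (assign y))))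

    LeafEdgeAt : Fin (suc k) → Fin n × Fin n → Set
    LeafEdgeAt j g = ∃ λ u → Leaf u × Joins u (v j) g

    EdgeKind : Fin n × Fin n → Set
    EdgeKind g = (∃ λ j → LeafEdgeAt j g) ⊎ (∃ λ i → g ≡ bodyEdge i)

    edgeAt-kind : ∀ p → (∃ λ j → LeafEdgeAt j (edgeAt p)) ⊎ (∃ λ i → p ≡ bodyPos i)
    edgeAt-kind p with leaf? (proj₁ (edgeAt p)) | leaf? (proj₂ (edgeAt p))
    ... | yes leaf₁ | yes leaf₂ = ⊥-elim (no-edge-between-leaves p leaf₁ leaf₂)
    ... | yes leaf₁ | no ¬leaf₂ with body _ ¬leaf₂
    ...   | j , vj≡ = inj₁ (j , _ , leaf₁ , inj₁ (cong (proj₁ (edgeAt p) ,_) (sym vj≡)))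
    edgeAt-kind p | no ¬leaf₁ | yes leaf₂ with body _ ¬leaf₁
    ...   | j , vj≡ = inj₁ (j , _ , leaf₂ , inj₂ (cong (_, proj₂ (edgeAt p)) (sym vj≡)))
    edgeAt-kind p | no ¬leaf₁ | no ¬leaf₂ = inj₂ (inner⇒body p (¬leaf₁ , ¬leaf₂))

    edge-kind : ∀ {g} → g ∈ E → EdgeKind g
    edge-kind g∈ with edgeAt-kind (index g∈)
    ... | inj₁ (j , leafEdge) = inj₁ (j , subst (LeafEdgeAt j) (edgeAt-index g∈) leafEdge)
    ... | inj₂ (i , pos≡) = inj₂ (i , trans (sym (edgeAt-index g∈)) (cong edgeAt pos≡))

    leafEdge-¬inner : ∀ {j g} → LeafEdgeAt j g → ¬ Inner g
    leafEdge-¬inner (u , leaf , joins) inner = inner-¬incident-leaf inner leaf (joins-incidentˡ joins)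

    edgeAt-injective : ∀ p q → edgeAt p ≡ edgeAt q → p ≡ q
    edgeAt-injective p q same with edgeAt-kind p
    ... | inj₁ (j , u , leaf , joins) =
      leaf-incident-unique leaf p q (joins-incidentˡ joins) (subst (Incident u) same (joins-incidentˡ joins))
    ... | inj₂ (i , refl) with edgeAt-kind q
    ...   | inj₁ (j , leafEdge) = ⊥-elim (leafEdge-¬inner leafEdge (subst Inner same (bodyEdge-inner (bodyEdge-isBodyEdge i))))
    ...   | inj₂ (i′ , refl) = cong bodyPos (isBodyEdge-injective (bodyEdge-isBodyEdge i) (subst (BodyEdge i′) (sym same) (bodyEdge-isBodyEdge i′)))

    unique-E : Unique E
    unique-E = lookup-injective⇒unique E edgeAt-injective

    bodyIndex : Fin n → ℕ
    bodyIndex u with Fₚ.any? (λ j → v j ≟ u)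
    ... | yes (j , _) = toℕ j
    ... | no _ = 0

    bodyIndex-v : ∀ j → bodyIndex (v j) ≡ toℕ j
    bodyIndex-v j with Fₚ.any? (λ j′ → v j′ ≟ v j)
    ... | yes (j′ , vj′≡vj) = cong toℕ (injective j′ j vj′≡vj)
    ... | no none = ⊥-elim (none (j , refl))

    -- Leaf edges at v j get rank 2 j, the body edge between v i and v (i + 1) gets 2 i + 1.
    rank : Fin n × Fin n → ℕ
    rank (a , b) with leaf? a | leaf? b
    ... | yes _ | _ = 2 * bodyIndex b
    ... | no _ | yes _ = 2 * bodyIndex a
    ... | no _ | no _ = suc (2 * (bodyIndex a ⊓ bodyIndex b))

    rank-leafEdge : ∀ {j g} → LeafEdgeAt j g → rank g ≡ 2 * toℕ j
    rank-leafEdge {j} (u , leaf , inj₁ refl) with leaf? u | leaf? (v j)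
    ... | yes _ | _ = cong (2 *_) (bodyIndex-v j)
    ... | no ¬leaf | _ = ⊥-elim (¬leaf leaf)
    rank-leafEdge {j} (u , leaf , inj₂ refl) with leaf? (v j) | leaf? u
    ... | yes leaf-vj | _ = ⊥-elim (bodyNoLeaf j leaf-vj)
    ... | no _ | yes _ = cong (2 *_) (bodyIndex-v j)
    ... | no _ | no ¬leaf = ⊥-elim (¬leaf leaf)

    rank-bodyEdge′ : ∀ {i g} → BodyEdge i g → rank g ≡ suc (2 * toℕ i)
    rank-bodyEdge′ {i} (inj₁ refl) with leaf? (v (inject₁ i)) | leaf? (v (suc i))
    ... | yes leaf | _ = ⊥-elim (bodyNoLeaf (inject₁ i) leaf)
    ... | no _ | yes leaf = ⊥-elim (bodyNoLeaf (suc i) leaf)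
    ... | no _ | no _ = cong (λ m → suc (2 * m))
          (trans (cong₂ _⊓_ (trans (bodyIndex-v (inject₁ i)) (Fₚ.toℕ-inject₁ i)) (bodyIndex-v (suc i))) (ℕₚ.m≤n⇒m⊓n≡m (ℕₚ.n≤1+n _)))
    rank-bodyEdge′ {i} (inj₂ refl) with leaf? (v (suc i)) | leaf? (v (inject₁ i))
    ... | yes leaf | _ = ⊥-elim (bodyNoLeaf (suc i) leaf)
    ... | no _ | yes leaf = ⊥-elim (bodyNoLeaf (inject₁ i) leaf)
    ... | no _ | no _ = cong (λ m → suc (2 * m))
          (trans (cong₂ _⊓_ (bodyIndex-v (suc i)) (trans (bodyIndex-v (inject₁ i)) (Fₚ.toℕ-inject₁ i))) (ℕₚ.m≥n⇒m⊓n≡n (ℕₚ.n≤1+n _)))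

    rank-bodyEdge : ∀ i → rank (bodyEdge i) ≡ suc (2 * toℕ i)
    rank-bodyEdge i = rank-bodyEdge′ (bodyEdge-isBodyEdge i)

    edge-rank : ∀ {g} → g ∈ E →
      (∃ λ j → LeafEdgeAt j g × rank g ≡ 2 * toℕ j) ⊎ (∃ λ i → g ≡ bodyEdge i × rank g ≡ suc (2 * toℕ i))
    edge-rank g∈ with edge-kind g∈
    ... | inj₁ (j , leafEdge) = inj₁ (j , leafEdge , rank-leafEdge leafEdge)
    ... | inj₂ (i , refl) = inj₂ (i , refl , rank-bodyEdge i)

    rank-odd⇒bodyEdge : ∀ {g} i → g ∈ E → rank g ≡ suc (2 * toℕ i) → g ≡ bodyEdge i
    rank-odd⇒bodyEdge i g∈ rank≡ with edge-rank g∈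
    ... | inj₁ (j , _ , rank≡′) = ⊥-elim (ℕₚ.even≢odd (toℕ j) (toℕ i) (trans (sym rank≡′) rank≡))
    ... | inj₂ (i′ , refl , rank≡′) =
      cong bodyEdge (Fₚ.toℕ-injective (ℕₚ.*-cancelˡ-≡ (toℕ i′) (toℕ i) 2 (ℕₚ.suc-injective (trans (sym rank≡′) rank≡))))

    no-loop : ∀ {g} → g ∈ E → proj₁ g ≢ proj₂ g
    no-loop g∈ loop with edge-kind g∈
    ... | inj₁ (j , u , leaf , inj₁ refl) = bodyNoLeaf j (subst Leaf loop leaf)
    ... | inj₁ (j , u , leaf , inj₂ refl) = bodyNoLeaf j (subst Leaf (sym loop) leaf)
    ... | inj₂ (i , refl) with bodyEdge-isBodyEdge i
    ...   | inj₁ eq = inject₁≢suc (injective _ _ (trans (cong proj₁ (sym eq)) (trans loop (cong proj₂ eq))))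
    ...   | inj₂ eq = inject₁≢suc (injective _ _ (trans (cong proj₂ (sym eq)) (trans (sym loop) (cong proj₁ eq))))

    swap∈E⇒≡ : ∀ {g} → g ∈ E → swap g ∈ E → g ≡ swap g
    swap∈E⇒≡ {g} g∈ g′∈ with edge-kind g∈
    ... | inj₁ (j , u , leaf , joins) = leaf-edge-unique leaf g∈ g′∈ (joins-incidentˡ joins) (flip-incident (joins-incidentˡ joins))
      where
      flip-incident : ∀ {x h} → Incident x h → Incident x (swap h)
      flip-incident (inj₁ eq) = inj₂ eq
      flip-incident (inj₂ eq) = inj₁ eq
    ... | inj₂ (i , refl) with edge-kind g′∈
    ...   | inj₁ (j , leafEdge) = ⊥-elim (leafEdge-¬inner leafEdge (swap (bodyEdge-inner (bodyEdge-isBodyEdge i))))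
    ...   | inj₂ (i′ , g′≡)
      with isBodyEdge-injective (flip-joins (bodyEdge-isBodyEdge i)) (subst (BodyEdge i′) (sym g′≡) (bodyEdge-isBodyEdge i′))
      where
      flip-joins : ∀ {a b h} → Joins a b h → Joins a b (swap h)
      flip-joins (inj₁ refl) = inj₂ refl
      flip-joins (inj₂ refl) = inj₁ refl
    ...     | refl = sym g′≡

    swap∉E : ∀ {g} → g ∈ E → swap g ∉ E
    swap∉E g∈ g′∈ = no-loop g∈ (cong proj₁ (swap∈E⇒≡ g∈ g′∈))

    NearRank : Fin (suc k) → Fin n × Fin n → Set
    NearRank j g = 2 * toℕ j ≤ suc (rank g) × rank g ≤ suc (2 * toℕ j)

    incident-vertex : ∀ {g y} → g ∈ E → Incident y g → Leaf y ⊎ ∃ λ j → v j ≡ y × NearRank j g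
    incident-vertex g∈ inc with edge-rank g∈
    ... | inj₁ (j , (u , leaf , joins) , rank≡) with joins-incident joins inc
    ...   | inj₁ refl = inj₁ leaf
    ...   | inj₂ refl = inj₂ (j , refl , subst (λ r → 2 * toℕ j ≤ suc r) (sym rank≡) (ℕₚ.n≤1+n _) ,
                                         subst (_≤ suc (2 * toℕ j)) (sym rank≡) (ℕₚ.n≤1+n _))
    incident-vertex g∈ inc | inj₂ (i , refl , rank≡) with joins-incident (bodyEdge-isBodyEdge i) inc
    ... | inj₁ refl = inj₂ (inject₁ i , refl , subst (λ r → 2 * r ≤ suc (rank (bodyEdge i))) (sym (Fₚ.toℕ-inject₁ i)) lower ,
                                          subst (λ r → rank (bodyEdge i) ≤ suc (2 * r)) (sym (Fₚ.toℕ-inject₁ i)) (ℕₚ.≤-reflexive rank≡))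
      where
      lower : 2 * toℕ i ≤ suc (rank (bodyEdge i))
      lower = ℕₚ.≤-trans (ℕₚ.n≤1+n _) (ℕₚ.≤-trans (ℕₚ.n≤1+n _) (ℕₚ.≤-reflexive (cong suc (sym rank≡))))
    ... | inj₂ refl = inj₂ (suc i , refl , ℕₚ.≤-reflexive (trans (ℕₚ.*-suc 2 (toℕ i)) (cong suc (sym rank≡))) ,
                                          ℕₚ.≤-trans (ℕₚ.≤-reflexive rank≡) (s≤s (ℕₚ.*-monoʳ-≤ 2 (ℕₚ.n≤1+n (toℕ i)))))

    2m≤1+2n⇒m≤n : ∀ {m n} → 2 * m ≤ suc (2 * n) → m ≤ n
    2m≤1+2n⇒m≤n {m} {n} 2m≤ =
      ℕₚ.≤-pred (ℕₚ.*-cancelˡ-< 2 m (suc n) (ℕₚ.≤-trans (s≤s 2m≤) (ℕₚ.≤-reflexive (sym (ℕₚ.*-suc 2 n)))))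

module PendantDeletion where

  open import Data.Nat using (ℕ; suc; _≤_; _<_; s≤s)
  import Data.Nat.Properties as ℕₚ
  open import Data.Bool using (Bool; true; false; _∧_; not; T)
  open import Data.Bool.Properties using (∧-conicalˡ; ∧-conicalʳ; ∧-zeroʳ; T-≡; T-not-≡; T-∧)
  open import Function.Bundles using (Equivalence)
  open import Data.Fin using (Fin)
  open import Data.List using (List; []; _∷_; _++_; filterᵇ; length)
  open import Data.List.Properties using (filter-++; filter-all; filter-reject)
  open import Data.List.Membership.Propositional using (_∈_; _∉_)
  open import Data.List.Membership.Propositional.Properties using (∈-filter⁺; ∈-filter⁻; ∈-∃++; ∈-++⁺ˡ; ∈-++⁺ʳ)
  open import Data.List.Relation.Unary.Any using (here; there)
  open import Data.List.Relation.Unary.All using (All)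
  import Data.List.Relation.Unary.All as All
  open import Data.List.Relation.Unary.Unique.Propositional using (Unique)
  import Data.List.Relation.Unary.Unique.Propositional.Properties as Unique
  open import Data.List.Relation.Binary.Permutation.Propositional using (_↭_; ↭-sym)
  import Data.List.Relation.Binary.Permutation.Propositional.Properties as ↭
  open import Data.Product using (_×_; _,_; proj₁; proj₂; ∃)
  open import Data.Sum using (inj₁; inj₂)
  open import Data.Empty using (⊥-elim)
  open import Function using (_∘_)
  open import Relation.Binary.PropositionalEquality using (_≡_; _≢_; refl; sym; trans; cong; cong₂; subst; module ≡-Reasoning)
  open import Relation.Nullary using (¬_; yes; no; does)
  open import Relation.Nullary.Decidable using (T?)
  open import Defs
  open ListFacts
  open Transpositions

  module _ {A : Set} where

    filterᵇ-∧ : (P Q : A → Bool) (xs : List A) → filterᵇ (λ x → P x ∧ Q x) xs ≡ filterᵇ Q (filterᵇ P xs)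
    filterᵇ-∧ P Q [] = refl
    filterᵇ-∧ P Q (x ∷ xs) with P x
    ... | false = filterᵇ-∧ P Q xs
    ... | true with Q x
    ...   | false = filterᵇ-∧ P Q xs
    ...   | true = cong (x ∷_) (filterᵇ-∧ P Q xs)

    filterᵇ-length-< : (Q R : A → Bool) (xs : List A) → (∀ {x} → x ∈ xs → Q x ≡ true → R x ≡ true) →
      ∀ {a} → a ∈ xs → R a ≡ true → Q a ≡ false → length (filterᵇ Q xs) < length (filterᵇ R xs)
    filterᵇ-length-< Q R (x ∷ xs) Q⊆R (here refl) Ra Qa rewrite Ra | Qa = s≤s (length-≤ xs (Q⊆R ∘ there))
      where
      length-≤ : ∀ ys → (∀ {y} → y ∈ ys → Q y ≡ true → R y ≡ true) → length (filterᵇ Q ys) ≤ length (filterᵇ R ys)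
      length-≤ [] _ = ℕₚ.≤-refl
      length-≤ (y ∷ ys) Q⊆R′ with Q y in Qy | R y in Ry
      ... | false | false = length-≤ ys (Q⊆R′ ∘ there)
      ... | false | true = ℕₚ.m≤n⇒m≤1+n (length-≤ ys (Q⊆R′ ∘ there))
      ... | true | true = s≤s (length-≤ ys (Q⊆R′ ∘ there))
      ... | true | false with trans (sym (Q⊆R′ (here refl) Qy)) Ry
      ...   | ()
    filterᵇ-length-< Q R (x ∷ xs) Q⊆R (there a∈) Ra Qa with Q x in Qx | R x in Rx
    ... | false | false = filterᵇ-length-< Q R xs (Q⊆R ∘ there) a∈ Ra Qa
    ... | false | true = ℕₚ.m≤n⇒m≤1+n (filterᵇ-length-< Q R xs (Q⊆R ∘ there) a∈ Ra Qa)
    ... | true | true = s≤s (filterᵇ-length-< Q R xs (Q⊆R ∘ there) a∈ Ra Qa)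
    ... | true | false with trans (sym (Q⊆R (here refl) Qx)) Rx
    ...   | ()

    filterᵇ-cong-∈ : (P Q : A → Bool) (xs : List A) → (∀ {x} → x ∈ xs → P x ≡ Q x) → filterᵇ P xs ≡ filterᵇ Q xs
    filterᵇ-cong-∈ P Q [] _ = refl
    filterᵇ-cong-∈ P Q (x ∷ xs) P≗Q rewrite P≗Q (here refl) with Q x
    ... | false = filterᵇ-cong-∈ P Q xs (P≗Q ∘ there)
    ... | true = cong (x ∷_) (filterᵇ-cong-∈ P Q xs (P≗Q ∘ there))

  T⇒≡true : ∀ {b} → T b → b ≡ true
  T⇒≡true = Equivalence.to T-≡

  ≡true⇒T : ∀ {b} → b ≡ true → T b
  ≡true⇒T = Equivalence.from T-≡

  EdgeSet : ℕ → Set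
  EdgeSet n = Fin n × Fin n → Bool

  module _ {n : ℕ} where

    other-than : Fin n × Fin n → EdgeSet n
    other-than g h = not (does (h ≟e g))

    other-than-self : ∀ g → other-than g g ≡ false
    other-than-self g with g ≟e g
    ... | yes _ = refl
    ... | no g≢g = ⊥-elim (g≢g refl)

    other-than-other : ∀ {g h} → h ≢ g → other-than g h ≡ true
    other-than-other {g} {h} h≢g with h ≟e g
    ... | yes h≡g = ⊥-elim (h≢g h≡g)
    ... | no _ = refl

    _without_ : EdgeSet n → Fin n × Fin n → EdgeSet n
    (P without g) h = P h ∧ other-than g h

  module _ {n : ℕ} (E : Edges n) (unique-E : Unique E) where

    record Pendant (P : EdgeSet n) (g : Fin n × Fin n) : Set where
      field
        g∈E : g ∈ E
        g∈P : P g ≡ true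
        stem tip : Fin n
        stem≢tip : stem ≢ tip
        joins : Joins stem tip g
        only : ∀ {h} → h ∈ E → P h ≡ true → Incident tip h → h ≡ g

    prodFun-delete-pendant-edge : ∀ P g (pendant : Pendant P g) {u} → u ↭ E → ∀ z →
      prodFun (filterᵇ (P without g) u) z ≡ splice (prodFun (filterᵇ P u)) (Pendant.tip pendant) z
    prodFun-delete-pendant-edge P g pendant {u} u↭ z
      with ∈-∃++ (∈-filter⁺ (T? ∘ P) (↭.∈-resp-↭ (↭-sym u↭) (Pendant.g∈E pendant)) (≡true⇒T (Pendant.g∈P pendant)))
    ... | p , q , restricted≡ = begin
      prodFun (filterᵇ (P without g) u) z      ≡⟨ cong (λ l → prodFun l z) deleted≡ ⟩
      prodFun (p ++ q) z
        ≡⟨ prodFun-delete-pendant stem tip p q (avoids p ∈-++⁺ˡ g∉p) (avoids q (∈-++⁺ʳ p ∘ there) g∉q) z ⟩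
      splice (prodFun (p ++ (stem , tip) ∷ q)) tip z ≡⟨ splice-cong tip oriented z ⟩
      splice (prodFun (p ++ g ∷ q)) tip z      ≡⟨ cong (λ l → splice (prodFun l) tip z) (sym restricted≡) ⟩
      splice (prodFun (filterᵇ P u)) tip z     ∎
      where
      open Pendant pendant
      open ≡-Reasoning
      unique-restricted : Unique (p ++ g ∷ q)
      unique-restricted = subst Unique restricted≡ (Unique.filter⁺ (T? ∘ P) (unique-resp-↭ unique-E (↭-sym u↭)))
      g∉p = proj₁ (unique-∉-split p unique-restricted)
      g∉q = proj₂ (unique-∉-split p unique-restricted)
      restricted-∈ : ∀ {h} → h ∈ p ++ g ∷ q → h ∈ E × P h ≡ true
      restricted-∈ h∈ with ∈-filter⁻ (T? ∘ P) {xs = u} (subst (_ ∈_) (sym restricted≡) h∈)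
      ... | h∈u , Ph = ↭.∈-resp-↭ u↭ h∈u , T⇒≡true Ph
      avoids : ∀ r → (∀ {h} → h ∈ r → h ∈ p ++ g ∷ q) → g ∉ r → All (¬_ ∘ Incident tip) r
      avoids r r⊆ g∉r = All.tabulate λ h∈r inc →
        g∉r (subst (_∈ r) (only (proj₁ (restricted-∈ (r⊆ h∈r))) (proj₂ (restricted-∈ (r⊆ h∈r))) inc) h∈r)
      all≢ : ∀ r → g ∉ r → filterᵇ (other-than g) r ≡ r
      all≢ r g∉r = filter-all (T? ∘ other-than g) (All.tabulate λ {h} h∈r → ≡true⇒T (other-than-other {g = g} {h} λ { refl → g∉r h∈r }))
      deleted≡ : filterᵇ (P without g) u ≡ p ++ q
      deleted≡ = begin
        filterᵇ (P without g) u                                  ≡⟨ filterᵇ-∧ P (other-than g) u ⟩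
        filterᵇ (other-than g) (filterᵇ P u)                     ≡⟨ cong (filterᵇ (other-than g)) restricted≡ ⟩
        filterᵇ (other-than g) (p ++ g ∷ q)                      ≡⟨ filter-++ (T? ∘ other-than g) p (g ∷ q) ⟩
        filterᵇ (other-than g) p ++ filterᵇ (other-than g) (g ∷ q)
          ≡⟨ cong₂ _++_ (all≢ p g∉p) (trans (filter-reject (T? ∘ other-than g) {x = g} {xs = q} (subst T (other-than-self g))) (all≢ q g∉q)) ⟩
        p ++ q                                                   ∎
      oriented : ∀ z → prodFun (p ++ (stem , tip) ∷ q) z ≡ prodFun (p ++ g ∷ q) z
      oriented z with joins
      ... | inj₁ refl = refl
      ... | inj₂ refl = prodFun-flip-mid p q stem tip z

    module _ (K : EdgeSet n) where

      Outside : EdgeSet n → Edges n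
      Outside P = filterᵇ (λ h → P h ∧ not (K h)) E

      Contains : EdgeSet n → Set
      Contains P = ∀ {h} → h ∈ E → K h ≡ true → P h ≡ true

      PendantsOutside : Set
      PendantsOutside = ∀ P → Contains P → ∀ {h} → h ∈ Outside P → ∃ λ g → K g ≡ false × Pendant P g

      SameProductOn : EdgeSet n → Edges n → Edges n → Set
      SameProductOn P w w′ = ∀ z → prodFun (filterᵇ P w) z ≡ prodFun (filterᵇ P w′) z

      ∈-Outside⁻ : ∀ P {h} → h ∈ Outside P → h ∈ E × P h ≡ true × K h ≡ false
      ∈-Outside⁻ P h∈ with ∈-filter⁻ (T? ∘ (λ h → P h ∧ not (K h))) {xs = E} h∈
      ... | h∈E , inside = h∈E , ∧-conicalˡ _ _ (T⇒≡true inside) , Equivalence.to T-not-≡ (proj₂ (Equivalence.to T-∧ inside))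

      ∈-Outside⁺ : ∀ P {h} → h ∈ E → P h ≡ true → K h ≡ false → h ∈ Outside P
      ∈-Outside⁺ P h∈E Ph Kh = ∈-filter⁺ (T? ∘ (λ h → P h ∧ not (K h))) h∈E (≡true⇒T (cong₂ _∧_ Ph (cong not Kh)))

      -- Deleting pendant edges outside K one at a time, each step acts on both products as the same splice.
      same-product-on-kept : PendantsOutside → ∀ {w w′} → w ↭ E → w′ ↭ E →
        (∀ z → prodFun w z ≡ prodFun w′ z) → SameProductOn K w w′
      same-product-on-kept pendants {w} {w′} w↭ w′↭ same =
        reduce (length (Outside (λ _ → true))) (λ _ → true) ℕₚ.≤-refl (λ _ _ → refl)
          (λ z → trans (cong (λ l → prodFun l z) (filterᵇ-true w)) (trans (same z) (cong (λ l → prodFun l z) (sym (filterᵇ-true w′)))))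
        where
        filterᵇ-true : ∀ (u : Edges n) → filterᵇ (λ _ → true) u ≡ u
        filterᵇ-true [] = refl
        filterᵇ-true (x ∷ u) = cong (x ∷_) (filterᵇ-true u)
        agrees-with-K : ∀ P → Contains P → Outside P ≡ [] → ∀ u → u ↭ E → filterᵇ P u ≡ filterᵇ K u
        agrees-with-K P contains none u u↭ = filterᵇ-cong-∈ P K u (λ h∈ → P≡K (↭.∈-resp-↭ u↭ h∈))
          where
          P≡K : ∀ {h} → h ∈ E → P h ≡ K h
          P≡K {h} h∈E with K h in Kh
          ... | true = contains h∈E Kh
          ... | false with P h in Ph
          ...   | false = refl
          ...   | true with subst (h ∈_) none (∈-Outside⁺ P h∈E Ph Kh)
          ...     | ()
        reduce : ∀ c P → length (Outside P) ≤ c → Contains P → SameProductOn P w w′ → SameProductOn K w w′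
        reduce c P ≤c contains same-P with Outside P in outside≡
        ... | [] = λ z → trans (sym (cong (λ l → prodFun l z) (agrees-with-K P contains outside≡ w w↭)))
                           (trans (same-P z) (cong (λ l → prodFun l z) (agrees-with-K P contains outside≡ w′ w′↭)))
        reduce (suc c) P ≤c contains same-P | h ∷ _ with pendants P contains (subst (h ∈_) (sym outside≡) (here refl))
        ... | g , Kg , pendant = reduce c (P without g) ≤c′ contains′ same-P′
          where
          open Pendant pendant
          contains′ : Contains (P without g)
          contains′ {h′} h′∈E Kh′ with h′ ≟e g
          ... | yes refl with trans (sym Kh′) Kg
          ...   | ()
          contains′ {h′} h′∈E Kh′ | no _ = cong₂ _∧_ (contains h′∈E Kh′) refl
          shrinks : length (Outside (P without g)) < length (Outside P)
          shrinks = filterᵇ-length-< _ _ E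
            (λ {x} _ inside → cong₂ _∧_ (∧-conicalˡ (P x) _ (∧-conicalˡ (P x ∧ other-than g x) _ inside))
                                         (∧-conicalʳ (P x ∧ other-than g x) _ inside))
            g∈E (cong₂ _∧_ g∈P (cong not Kg)) (cong (_∧ not (K g)) (trans (cong (P g ∧_) (other-than-self g)) (∧-zeroʳ (P g))))
          ≤c′ : length (Outside (P without g)) ≤ c
          ≤c′ = ℕₚ.≤-pred (ℕₚ.≤-trans shrinks (subst (λ l → length l ≤ suc c) (sym outside≡) ≤c))
          same-P′ : SameProductOn (P without g) w w′
          same-P′ z = trans (prodFun-delete-pendant-edge P g pendant w↭ z)
                        (trans (splice-cong tip same-P z) (sym (prodFun-delete-pendant-edge P g pendant w′↭ z)))

module Separation where

  open import Data.Nat using (suc; _*_; _≤_; s≤s)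
  import Data.Nat.Properties as ℕₚ
  open import Data.Bool using (true; false)
  import Data.Bool as Bool
  open import Data.Fin using (Fin; suc; inject₁; toℕ)
  import Data.Fin.Properties as Fₚ
  open import Data.List using ([]; _∷_; filter)
  open import Data.List.Membership.Propositional using (_∈_; find; lose)
  open import Data.List.Relation.Unary.Any using (any?)
  open import Data.List.Relation.Unary.All using (All)
  import Data.List.Relation.Unary.All as All
  open import Data.List.Relation.Binary.Permutation.Propositional using (_↭_; ↭-sym)
  import Data.List.Relation.Binary.Permutation.Propositional.Properties as ↭
  open import Data.Product using (_×_; _,_; proj₁; proj₂; ∃)
  open import Data.Sum using (_⊎_; inj₁; inj₂)
  import Data.Sum as Sum
  open import Data.Sum using ([_,_]′)
  open import Data.Empty using (⊥; ⊥-elim)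
  open import Function using (_∘_)
  open import Relation.Binary.PropositionalEquality using (_≡_; _≢_; refl; sym; trans; cong; subst; subst₂)
  open import Relation.Nullary using (¬_; Dec; yes; no; does)
  open import Relation.Nullary.Decidable using (_×-dec_; ¬?)
  open import Defs
  open ListFacts
  open Transpositions
  open Chains
  open PendantDeletion
  open CaterpillarEdges

  module _ {n k} (E : Edges n) (v : Fin (suc k) → Fin n) (C : IsCaterpillarWithBody E v) where
    open Caterpillar E v C

    OtherEdgeAt : EdgeSet n → Fin n × Fin n → Fin n → Set
    OtherEdgeAt P g y = ∃ λ h → h ∈ E × P h ≡ true × Incident y h × h ≢ g

    otherEdgeAt? : ∀ P g y → Dec (OtherEdgeAt P g y)
    otherEdgeAt? P g y with any? (λ h → (P h Bool.≟ true) ×-dec incident? y h ×-dec ¬? (h ≟e g)) E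
    ... | yes some with find some
    ...   | h , h∈ , found = yes (h , h∈ , found)
    otherEdgeAt? P g y | no none = no λ (h , h∈ , found) → none (lose h∈ found)

    alone⇒pendant : ∀ P {g stem tip} → g ∈ E → P g ≡ true → stem ≢ tip → Joins stem tip g →
      ¬ OtherEdgeAt P g tip → Pendant E unique-E P g
    alone⇒pendant P {g} {stem} {tip} g∈ Pg stem≢tip joins alone = record
      { g∈E = g∈ ; g∈P = Pg ; stem = stem ; tip = tip ; stem≢tip = stem≢tip ; joins = joins ; only = only }
      where
      only : ∀ {h} → h ∈ E → P h ≡ true → Incident tip h → h ≡ g
      only {h} h∈ Ph inc with h ≟e g
      ... | yes h≡g = h≡g
      ... | no h≢g = ⊥-elim (alone (h , h∈ , Ph , inc , h≢g))

    leafEdge-pendant : ∀ P {j g} → g ∈ E → P g ≡ true → LeafEdgeAt j g → Pendant E unique-E P g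
    leafEdge-pendant P {j} g∈ Pg (u , leaf , joins) = record
      { g∈E = g∈ ; g∈P = Pg ; stem = v j ; tip = u
      ; stem≢tip = λ vj≡u → bodyNoLeaf j (subst Leaf (sym vj≡u) leaf)
      ; joins = Sum.swap joins
      ; only = λ h∈ _ inc → leaf-edge-unique leaf h∈ g∈ inc (joins-incidentˡ joins) }

    module _ {e f} (e∈ : e ∈ E) (f∈ : f ∈ E) (e≢f : e ≢ f) (share : Share e f) where

      kept : EdgeSet n
      kept = does ∘ oneOf? _≟e_ e f

      kept⇒ : ∀ {h} → kept h ≡ true → h ≡ e ⊎ h ≡ f
      kept⇒ {h} kept-h with h ≟e e | h ≟e f
      ... | yes h≡e | _ = inj₁ h≡e
      ... | no _ | yes h≡f = inj₂ h≡f

      private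
        s : Fin n
        s = proj₁ share

        s-¬leaf : ¬ Leaf s
        s-¬leaf leaf = e≢f (leaf-edge-unique leaf e∈ f∈ (proj₁ (proj₂ share)) (proj₂ (proj₂ share)))

        c : Fin (suc k)
        c = proj₁ (body s s-¬leaf)

        near-s : ∀ {h} → h ∈ E → Incident s h → NearRank c h
        near-s h∈ inc with incident-vertex h∈ inc
        ... | inj₁ leaf = ⊥-elim (s-¬leaf leaf)
        ... | inj₂ (j , vj≡s , near) with injective j c (trans vj≡s (sym (proj₂ (body s s-¬leaf))))
        ...   | refl = near

      kept-near : ∀ {h} → kept h ≡ true → NearRank c h
      kept-near {h} kept-h with kept⇒ {h} kept-h
      ... | inj₁ refl = near-s e∈ (proj₁ (proj₂ share))
      ... | inj₂ refl = near-s f∈ (proj₂ (proj₂ share))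

      private
        Out : EdgeSet n → Edges n
        Out = Outside E unique-E kept

        ∈-Out⁻ : ∀ P {h} → h ∈ Out P → h ∈ E × P h ≡ true × kept h ≡ false
        ∈-Out⁻ = ∈-Outside⁻ E unique-E kept

        ∈-Out⁺ : ∀ P {h} → h ∈ E → P h ≡ true → kept h ≡ false → h ∈ Out P
        ∈-Out⁺ = ∈-Outside⁺ E unique-E kept

        v-inject₁≢v-suc : ∀ (i : Fin k) → v (inject₁ i) ≢ v (suc i)
        v-inject₁≢v-suc i eq = ℕₚ.1+n≢n (sym (trans (sym (Fₚ.toℕ-inject₁ i)) (cong toℕ (injective _ _ eq))))

      lower-end : ∀ P i → bodyEdge i ∈ Out P → All (λ h → rank (bodyEdge i) ≤ rank h) (Out P) →
        Pendant E unique-E P (bodyEdge i) ⊎ ∃ λ h → kept h ≡ true × rank h ≤ 2 * toℕ i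
      lower-end P i g∈ minimal with otherEdgeAt? P (bodyEdge i) (v (inject₁ i))
      ... | no alone = inj₁ (alone⇒pendant P (bodyEdge∈E i) (proj₁ (proj₂ (∈-Out⁻ P g∈)))
                               (v-inject₁≢v-suc i ∘ sym) (Sum.swap (bodyEdge-isBodyEdge i)) alone)
      ... | yes (h , h∈ , Ph , inc , h≢g) with incident-vertex h∈ inc
      ...   | inj₁ leaf = ⊥-elim (bodyNoLeaf (inject₁ i) leaf)
      ...   | inj₂ (j , vj≡ , _ , upper) with injective _ _ vj≡
      ...     | refl = inj₂ (h , kept-h , below)
        where
        below : rank h ≤ 2 * toℕ i
        below = ℕₚ.≤-pred (ℕₚ.≤∧≢⇒< (subst (λ t → rank h ≤ suc (2 * t)) (Fₚ.toℕ-inject₁ i) upper)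
                                      (h≢g ∘ rank-odd⇒bodyEdge i h∈))
        kept-h : kept h ≡ true
        kept-h with kept h in kept≡
        ... | true = refl
        ... | false = ⊥-elim (ℕₚ.<-irrefl refl
                        (ℕₚ.≤-trans (s≤s (subst (_≤ rank h) (rank-bodyEdge i) (All.lookup minimal (∈-Out⁺ P h∈ Ph kept≡))))
                                    (s≤s below)))

      upper-end : ∀ P i → bodyEdge i ∈ Out P → All (λ h → rank h ≤ rank (bodyEdge i)) (Out P) →
        Pendant E unique-E P (bodyEdge i) ⊎ ∃ λ h → kept h ≡ true × suc (suc (2 * toℕ i)) ≤ rank h
      upper-end P i g∈ maximal with otherEdgeAt? P (bodyEdge i) (v (suc i))
      ... | no alone = inj₁ (alone⇒pendant P (bodyEdge∈E i) (proj₁ (proj₂ (∈-Out⁻ P g∈)))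
                               (v-inject₁≢v-suc i) (bodyEdge-isBodyEdge i) alone)
      ... | yes (h , h∈ , Ph , inc , h≢g) with incident-vertex h∈ inc
      ...   | inj₁ leaf = ⊥-elim (bodyNoLeaf (suc i) leaf)
      ...   | inj₂ (j , vj≡ , lower , _) with injective _ _ vj≡
      ...     | refl = inj₂ (h , kept-h , above)
        where
        above : suc (suc (2 * toℕ i)) ≤ rank h
        above = ℕₚ.≤∧≢⇒< (ℕₚ.≤-pred (subst (_≤ suc (rank h)) (ℕₚ.*-suc 2 (toℕ i)) lower))
                          (h≢g ∘ rank-odd⇒bodyEdge i h∈ ∘ sym)
        kept-h : kept h ≡ true
        kept-h with kept h in kept≡
        ... | true = refl
        ... | false = ⊥-elim (ℕₚ.<-irrefl refl
                        (ℕₚ.≤-trans above (subst (rank h ≤_) (rank-bodyEdge i) (All.lookup maximal (∈-Out⁺ P h∈ Ph kept≡)))))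

      -- If neither extreme edge is pendant, kept edges lie below the minimum and above the maximum,
      -- so they cannot both be near the shared vertex v c.
      pendants-outside : PendantsOutside E unique-E kept
      pendants-outside P contains h∈ with minimum-∈ rank h∈ | maximum-∈ rank h∈
      ... | g , g∈ , minimal | g′ , g′∈ , maximal with ∈-Out⁻ P g∈ | ∈-Out⁻ P g′∈
      ... | g∈E , Pg , kept-g | g′∈E , Pg′ , kept-g′ with edge-kind g∈E | edge-kind g′∈E
      ... | inj₁ (_ , leafEdge) | _ = g , kept-g , leafEdge-pendant P g∈E Pg leafEdge
      ... | inj₂ _ | inj₁ (_ , leafEdge) = g′ , kept-g′ , leafEdge-pendant P g′∈E Pg′ leafEdge
      ... | inj₂ (i , refl) | inj₂ (i′ , refl) with lower-end P i g∈ minimal | upper-end P i′ g′∈ maximal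
      ...   | inj₁ pendant | _ = _ , kept-g , pendant
      ...   | inj₂ _ | inj₁ pendant = _ , kept-g′ , pendant
      ...   | inj₂ (h , kept-h , below) | inj₂ (h′ , kept-h′ , above) =
        ⊥-elim (ℕₚ.<-irrefl refl (ℕₚ.≤-trans i′<c (ℕₚ.≤-trans c≤i i≤i′)))
        where
        i≤i′ : toℕ i ≤ toℕ i′
        i≤i′ = ℕₚ.*-cancelˡ-≤ 2 (ℕₚ.≤-pred (subst₂ _≤_ (rank-bodyEdge i) (rank-bodyEdge i′) (All.lookup minimal g′∈)))
        c≤i : toℕ c ≤ toℕ i
        c≤i = 2m≤1+2n⇒m≤n (ℕₚ.≤-trans (proj₁ (kept-near kept-h)) (s≤s below))
        i′<c : suc (toℕ i′) ≤ toℕ c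
        i′<c = 2m≤1+2n⇒m≤n (subst (_≤ suc (2 * toℕ c)) (sym (ℕₚ.*-suc 2 (toℕ i′))) (ℕₚ.≤-trans above (proj₂ (kept-near kept-h′))))

    -- Sharing edges do not commute, yet restricted to {e , f} the two products agree.
    opposite-orders-impossible : ∀ {e f w w′} → e ∈ E → f ∈ E → e ≢ f → Share e f → w ↭ E → w′ ↭ E →
      (∀ z → prodFun w z ≡ prodFun w′ z) →
      filter (oneOf? _≟e_ e f) w ≡ e ∷ f ∷ [] → filter (oneOf? _≟e_ e f) w′ ≡ f ∷ e ∷ [] → ⊥
    opposite-orders-impossible {e} {f} {w} {w′} e∈ f∈ e≢f share w↭ w′↭ same ef fe =
      transpose-sharing-noncomm e f (no-loop e∈) (no-loop f∈) share
        [ e≢f , (λ e≡f′ → swap∉E f∈ (subst (_∈ E) e≡f′ e∈)) ]′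
        (λ z → trans (cong (λ l → prodFun l z) (sym ef)) (trans (kept-same z) (cong (λ l → prodFun l z) fe)))
      where
      kept-same : ∀ z → prodFun (filter (oneOf? _≟e_ e f) w) z ≡ prodFun (filter (oneOf? _≟e_ e f) w′) z
      kept-same z =
        subst₂ (λ l l′ → prodFun l z ≡ prodFun l′ z) (filterᵇ-does (oneOf? _≟e_ e f) w) (filterᵇ-does (oneOf? _≟e_ e f) w′)
          (same-product-on-kept E unique-E (kept e∈ f∈ e≢f share) (pendants-outside e∈ f∈ e≢f share) w↭ w′↭ same z)

    product-determines-order : ProductDeterminesOrderAtSharedVertices E
    product-determines-order {e} {f} e∈ f∈ e≢f share {w} {w′} w↭ w′↭ same with shape w↭ | shape w′↭
      where
      shape : ∀ {u} → u ↭ E → filter (oneOf? _≟e_ e f) u ≡ e ∷ f ∷ [] ⊎ filter (oneOf? _≟e_ e f) u ≡ f ∷ e ∷ []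
      shape u↭ = unique⇒filter-oneOf-shape _≟e_ (unique-resp-↭ unique-E (↭-sym u↭))
                   (↭.∈-resp-↭ (↭-sym u↭) e∈) (↭.∈-resp-↭ (↭-sym u↭) f∈) e≢f
    ... | inj₁ ef | inj₁ ef′ = trans ef (sym ef′)
    ... | inj₂ fe | inj₂ fe′ = trans fe (sym fe′)
    ... | inj₁ ef | inj₂ fe′ = ⊥-elim (opposite-orders-impossible e∈ f∈ e≢f share w↭ w′↭ same ef fe′)
    ... | inj₂ fe | inj₁ ef′ = ⊥-elim (opposite-orders-impossible e∈ f∈ e≢f share w′↭ w↭ (sym ∘ same) ef′ fe)

module LeafBlocks where

  open import Data.Nat using (suc; _*_; _≤_)
  import Data.Nat.Properties as ℕₚ
  open import Data.Fin using (Fin; suc; _≟_; inject₁; toℕ)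
  import Data.Fin.Properties as Fₚ
  open import Data.List using (List; map; filter; length; allFin)
  open import Data.List.Properties using (length-map; filter-some)
  open import Data.List.Membership.Propositional using (_∈_; lose)
  open import Data.List.Membership.Propositional.Properties using (∈-filter⁺; ∈-filter⁻; ∈-map⁺; ∈-map⁻; ∈-allFin; ∈-lookup)
  open import Data.List.Relation.Unary.Unique.Propositional using (Unique)
  import Data.List.Relation.Unary.Unique.Propositional.Properties as Unique
  open import Data.Product using (_×_; _,_; ∃)
  open import Data.Sum using (inj₁; inj₂)
  open import Data.Empty using (⊥-elim)
  open import Relation.Binary.PropositionalEquality using (_≡_; _≢_; refl; sym; trans; cong; subst)
  open import Function using (_∘_; flip)
  open import Relation.Nullary using (¬_; Dec; yes; no)
  open import Relation.Nullary.Decidable using (_×-dec_; ¬?)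
  open import Defs
  open ListFacts
  open Transpositions
  open CaterpillarEdges

  module _ {n k} (E : Edges n) (v : Fin (suc k) → Fin n) (C : IsCaterpillarWithBody E v) where
    open Caterpillar E v C
    open import Data.List.Membership.DecPropositional (_≟e_ {n}) using (_∈?_)

    leafNeighbour? : (j : Fin (suc k)) (u : Fin n) → Dec (Leaf u × Adj E u (v j))
    leafNeighbour? j u = leaf? u ×-dec adj? E u (v j)

    leafNeighbours : Fin (suc k) → List (Fin n)
    leafNeighbours j = filter (leafNeighbour? j) (allFin n)

    oriented : ∀ a b → Dec ((a , b) ∈ E) → Fin n × Fin n
    oriented a b (yes _) = a , b
    oriented a b (no _) = b , a

    oriented-joins : ∀ a b d → Joins a b (oriented a b d)
    oriented-joins a b (yes _) = inj₁ refl
    oriented-joins a b (no _) = inj₂ refl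

    oriented-∈ : ∀ a b d → Adj E a b → oriented a b d ∈ E
    oriented-∈ a b (yes ab∈) _ = ab∈
    oriented-∈ a b (no ab∉) (inj₁ ab∈) = ⊥-elim (ab∉ ab∈)
    oriented-∈ a b (no _) (inj₂ ba∈) = ba∈

    leafEdgeTo : Fin (suc k) → Fin n → Fin n × Fin n
    leafEdgeTo j u = oriented u (v j) ((u , v j) ∈? E)

    leafEdges : Fin (suc k) → Edges n
    leafEdges j = map (leafEdgeTo j) (leafNeighbours j)

    length-leafEdges : ∀ j → length (leafEdges j) ≡ leavesAt E (v j)
    length-leafEdges j = length-map (leafEdgeTo j) (leafNeighbours j)

    ∈-leafEdges⁻ : ∀ {j g} → g ∈ leafEdges j → g ∈ E × LeafEdgeAt j g
    ∈-leafEdges⁻ {j} g∈ with ∈-map⁻ (leafEdgeTo j) g∈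
    ... | u , u∈ , refl with ∈-filter⁻ (leafNeighbour? j) {xs = allFin n} u∈
    ... | _ , leaf , adj = oriented-∈ u (v j) _ adj , u , leaf , oriented-joins u (v j) _

    ∈-leafEdges⁺ : ∀ {j g} → g ∈ E → LeafEdgeAt j g → g ∈ leafEdges j
    ∈-leafEdges⁺ {j} {g} g∈ (u , leaf , joins) =
      subst (_∈ leafEdges j) (leafEdgeTo≡ joins ((u , v j) ∈? E))
        (∈-map⁺ (leafEdgeTo j) (∈-filter⁺ (leafNeighbour? j) (∈-allFin u) (leaf , adjacent joins)))
      where
      adjacent : Joins u (v j) g → Adj E u (v j)
      adjacent (inj₁ refl) = inj₁ g∈
      adjacent (inj₂ refl) = inj₂ g∈
      leafEdgeTo≡ : Joins u (v j) g → (d : Dec ((u , v j) ∈ E)) → oriented u (v j) d ≡ g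
      leafEdgeTo≡ (inj₁ refl) (yes _) = refl
      leafEdgeTo≡ (inj₁ refl) (no g∉) = ⊥-elim (g∉ g∈)
      leafEdgeTo≡ (inj₂ refl) (yes uv∈) = ⊥-elim (swap∉E g∈ uv∈)
      leafEdgeTo≡ (inj₂ refl) (no _) = refl

    unique-leafEdges : ∀ j → Unique (leafEdges j)
    unique-leafEdges j =
      unique-map-injectiveOn (leafEdgeTo j) (leafNeighbours j) (Unique.filter⁺ (leafNeighbour? j) (Unique.allFin⁺ n)) same-leaf
      where
      same-leaf : ∀ {a b} → a ∈ leafNeighbours j → b ∈ leafNeighbours j → leafEdgeTo j a ≡ leafEdgeTo j b → a ≡ b
      same-leaf {a} {b} a∈ b∈ same
        with ∈-filter⁻ (leafNeighbour? j) {xs = allFin n} a∈ | oriented-joins a (v j) ((a , v j) ∈? E)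
           | oriented-joins b (v j) ((b , v j) ∈? E)
      ... | _ , leaf-a , _ | ja | jb with joins-incident jb (subst (Incident a) same (joins-incidentˡ ja))
      ...   | inj₁ a≡b = a≡b
      ...   | inj₂ refl = ⊥-elim (bodyNoLeaf j leaf-a)

    rank≤2k : ∀ {g} → g ∈ E → rank g ≤ 2 * k
    rank≤2k g∈ with edge-rank g∈
    ... | inj₁ (j , _ , rank≡) = ℕₚ.≤-trans (ℕₚ.≤-reflexive rank≡) (ℕₚ.*-monoʳ-≤ 2 (ℕₚ.≤-pred (Fₚ.toℕ<n j)))
    ... | inj₂ (i , _ , rank≡) =
      ℕₚ.≤-trans (ℕₚ.≤-reflexive rank≡) (ℕₚ.≤-trans (ℕₚ.n≤1+n _) (ℕₚ.≤-trans (ℕₚ.≤-reflexive (sym (ℕₚ.*-suc 2 (toℕ i))))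
                                                                            (ℕₚ.*-monoʳ-≤ 2 (Fₚ.toℕ<n i))))

    other-incident-edge : ∀ {u} q → Incident u (edgeAt q) → ¬ Leaf u → ∃ λ p → p ≢ q × Incident u (edgeAt p)
    other-incident-edge {u} q inc ¬leaf with Fₚ.any? (λ p → ¬? (p ≟ q) ×-dec incident? u (edgeAt p))
    ... | yes found = found
    ... | no none = ⊥-elim (¬leaf (ℕₚ.≤-antisym (filter-length≤1 (incident? u) E q only-q)
                                                (filter-some (incident? u) (lose (∈-lookup {xs = E} q) inc))))
      where
      only-q : ∀ p → Incident u (edgeAt p) → p ≡ q
      only-q p inc-p with p ≟ q
      ... | yes p≡q = p≡q
      ... | no p≢q = ⊥-elim (none (p , p≢q , inc-p))

    private
      not-bodyEdge : ∀ {i p} → p ≢ bodyPos i → rank (edgeAt p) ≢ suc (2 * toℕ i)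
      not-bodyEdge {i} {p} p≢ rank≡ = p≢ (edgeAt-injective p (bodyPos i) (rank-odd⇒bodyEdge i (∈-lookup p) rank≡))

    first-leafEdge : (i : Fin k) → toℕ i ≡ 0 → ∃ λ g → g ∈ E × rank g ≡ 0
    first-leafEdge i i≡0 with other-incident-edge (bodyPos i) (joins-incidentˡ (bodyEdge-isBodyEdge i)) (bodyNoLeaf (inject₁ i))
    ... | p , p≢ , inc with incident-vertex (∈-lookup p) inc
    ...   | inj₁ leaf = ⊥-elim (bodyNoLeaf (inject₁ i) leaf)
    ...   | inj₂ (j , vj≡ , _ , upper) with injective _ _ vj≡
    ...     | refl = edgeAt p , ∈-lookup p ,
                     ℕₚ.n≤0⇒n≡0 (ℕₚ.≤-pred (ℕₚ.≤∧≢⇒< ≤1 (not-bodyEdge p≢ ∘ flip trans (cong (λ t → suc (2 * t)) (sym i≡0)))))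
      where
      ≤1 : rank (edgeAt p) ≤ 1
      ≤1 = subst (λ t → rank (edgeAt p) ≤ suc (2 * t)) (trans (Fₚ.toℕ-inject₁ i) i≡0) upper

    last-leafEdge : (i : Fin k) → suc (toℕ i) ≡ k → ∃ λ g → g ∈ E × rank g ≡ 2 * k
    last-leafEdge i i+1≡k with other-incident-edge (bodyPos i) (joins-incidentʳ (bodyEdge-isBodyEdge i)) (bodyNoLeaf (suc i))
    ... | p , p≢ , inc with incident-vertex (∈-lookup p) inc
    ...   | inj₁ leaf = ⊥-elim (bodyNoLeaf (suc i) leaf)
    ...   | inj₂ (j , vj≡ , lower , _) with injective _ _ vj≡
    ...     | refl = edgeAt p , ∈-lookup p , ℕₚ.≤-antisym (rank≤2k (∈-lookup p)) 2k≤
      where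
      2k≤ : 2 * k ≤ rank (edgeAt p)
      2k≤ = subst (λ t → 2 * t ≤ rank (edgeAt p)) i+1≡k
              (subst (_≤ rank (edgeAt p)) (sym (ℕₚ.*-suc 2 (toℕ i)))
                (ℕₚ.≤∧≢⇒< (ℕₚ.≤-pred (subst (_≤ suc (rank (edgeAt p))) (ℕₚ.*-suc 2 (toℕ i)) lower)) (not-bodyEdge p≢ ∘ sym)))

module CaterpillarChains where

  open import Data.Nat using (ℕ; suc; _*_; _≤_; _<_; z≤n; s≤s)
  import Data.Nat as ℕ
  import Data.Nat.Properties as ℕₚ
  open import Data.Fin using (Fin; suc; inject₁; toℕ; fromℕ<)
  import Data.Fin.Properties as Fₚ
  open import Data.List using ([]; _∷_; [_]; _++_; reverse)
  open import Data.List.Properties using (++-assoc)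
  open import Data.List.Membership.Propositional using (_∈_; _∉_)
  open import Data.List.Membership.Propositional.Properties using (∈-∃++; ∈-++⁺ˡ; ∈-++⁺ʳ)
  open import Data.List.Relation.Unary.Any using (here; there)
  open import Data.List.Relation.Unary.All using (All; []; _∷_)
  import Data.List.Relation.Unary.All as All
  open import Data.List.Relation.Unary.Linked using (_∷_)
  open import Data.List.Relation.Unary.Unique.Propositional using (Unique)
  open import Data.List.Relation.Binary.Permutation.Propositional using (_↭_; ↭-sym; ↭-trans)
  import Data.List.Relation.Binary.Permutation.Propositional.Properties as ↭
  open import Data.Product using (_×_; _,_; proj₁; proj₂; ∃)
  open import Data.Sum using (_⊎_; inj₁; inj₂)
  open import Data.Empty using (⊥; ⊥-elim)
  open import Function using (_∘_)
  open import Relation.Binary.PropositionalEquality using (_≡_; _≢_; refl; sym; trans; cong; subst; subst₂)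
  open import Relation.Nullary using (¬_; yes; no)
  open import Defs
  open ListFacts
  open Transpositions
  open Chains
  open BlockOrderings using (Sorted)
  open CaterpillarEdges

  module _ {n k} (E : Edges n) (v : Fin (suc k) → Fin n) (C : IsCaterpillarWithBody E v) where
    open Caterpillar E v C

    Below Above : Fin k → Fin n × Fin n → Set
    Below i g = rank g ≤ 2 * toℕ i
    Above i g = suc (suc (2 * toℕ i)) ≤ rank g

    below-above : ∀ {i g} → Below i g → Above i g → ⊥
    below-above below above = ℕₚ.<-irrefl refl (ℕₚ.≤-trans above (ℕₚ.≤-trans below (ℕₚ.n≤1+n _)))

    bodyEdge-¬below : ∀ {i} → ¬ Below i (bodyEdge i)
    bodyEdge-¬below {i} below = ℕₚ.<-irrefl refl (subst (_≤ 2 * toℕ i) (rank-bodyEdge i) below)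

    bodyEdge-¬above : ∀ {i} → ¬ Above i (bodyEdge i)
    bodyEdge-¬above {i} above = ℕₚ.<-irrefl refl (subst (suc (suc (2 * toℕ i)) ≤_) (rank-bodyEdge i) above)

    below-or-above : ∀ i {g} → g ∈ E → g ≢ bodyEdge i → Below i g ⊎ Above i g
    below-or-above i {g} g∈ g≢ with rank g ℕ.≤? 2 * toℕ i
    ... | yes below = inj₁ below
    ... | no ¬below = inj₂ (ℕₚ.≤∧≢⇒< (ℕₚ.≰⇒> ¬below) (g≢ ∘ rank-odd⇒bodyEdge i g∈ ∘ sym))

    -- The vertices of an edge below body edge i are among v 0 , … , v i and its leaves.
    no-share-across : ∀ i {a b} → a ∈ E → b ∈ E → Share a b → Below i a → Above i b → ⊥
    no-share-across i a∈ b∈ (y , inc-a , inc-b) below above with incident-vertex a∈ inc-a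
    ... | inj₁ leaf = below-above {i} below (subst (Above i) (sym (leaf-edge-unique leaf a∈ b∈ inc-a inc-b)) above)
    ... | inj₂ (j , vj≡y , lower , _) with incident-vertex b∈ inc-b
    ...   | inj₁ leaf = bodyNoLeaf j (subst Leaf (sym vj≡y) leaf)
    ...   | inj₂ (j′ , vj′≡y , _ , upper) with injective j′ j (trans vj′≡y (sym vj≡y))
    ...     | refl = ℕₚ.<-irrefl refl (ℕₚ.≤-trans i<j j≤i)
      where
      j≤i : toℕ j ≤ toℕ i
      j≤i = 2m≤1+2n⇒m≤n (ℕₚ.≤-trans lower (s≤s below))
      i<j : suc (toℕ i) ≤ toℕ j
      i<j = 2m≤1+2n⇒m≤n (subst (_≤ suc (2 * toℕ j)) (sym (ℕₚ.*-suc 2 (toℕ i))) (ℕₚ.≤-trans above upper))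

    chain-one-side : ∀ i c → Chain c → All (λ g → g ∈ E × g ≢ bodyEdge i) c → All (Below i) c ⊎ All (Above i) c
    chain-one-side i [] _ _ = inj₁ []
    chain-one-side i (g ∷ []) _ ((g∈ , g≢) ∷ []) with below-or-above i g∈ g≢
    ... | inj₁ below = inj₁ (below ∷ [])
    ... | inj₂ above = inj₂ (above ∷ [])
    chain-one-side i (g ∷ h ∷ c) (share ∷ chain) ((g∈ , g≢) ∷ rest@((h∈ , _) ∷ _))
      with chain-one-side i (h ∷ c) chain rest | below-or-above i g∈ g≢
    ... | inj₁ belows | inj₁ below = inj₁ (below ∷ belows)
    ... | inj₁ (below-h ∷ _) | inj₂ above = ⊥-elim (no-share-across i h∈ g∈ (share-sym share) below-h above)
    ... | inj₂ (above-h ∷ _) | inj₁ below = ⊥-elim (no-share-across i g∈ h∈ share below above-h)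
    ... | inj₂ aboves | inj₂ above = inj₂ (above ∷ aboves)

    Forward Backward : Edges n → Fin k → Set
    Forward w i = ∃ λ p → ∃ λ q → w ≡ p ++ bodyEdge i ∷ q × All (Below i) p × All (Above i) q
    Backward w i = ∃ λ p → ∃ λ q → w ≡ p ++ bodyEdge i ∷ q × All (Above i) p × All (Below i) q

    module _ {first last} (first∈ : first ∈ E) (rank-first : rank first ≡ 0)
                          (last∈ : last ∈ E) (rank-last : rank last ≡ 2 * k) where

      first-below : ∀ i → Below i first
      first-below i = subst (_≤ 2 * toℕ i) (sym rank-first) z≤n

      last-above : ∀ i → Above i last
      last-above i = subst (_≤ rank last) (ℕₚ.*-suc 2 (toℕ i))
                       (subst (2 * suc (toℕ i) ≤_) (sym rank-last) (ℕₚ.*-monoʳ-≤ 2 (Fₚ.toℕ<n i)))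

      module _ {w} (chain : Chain w) (w↭ : w ↭ E) where

        private
          unique-w : Unique w
          unique-w = unique-resp-↭ unique-E (↭-sym w↭)

          ∈w : ∀ {g} → g ∈ E → g ∈ w
          ∈w = ↭.∈-resp-↭ (↭-sym w↭)

          ∈E : ∀ {g} → g ∈ w → g ∈ E
          ∈E = ↭.∈-resp-↭ w↭

          off-body : ∀ i {r} → (∀ {g} → g ∈ r → g ∈ w) → bodyEdge i ∉ r → All (λ g → g ∈ E × g ≢ bodyEdge i) r
          off-body i r⊆w ∉r = All.tabulate λ g∈r → ∈E (r⊆w g∈r) , λ { refl → ∉r g∈r }

        orientation : ∀ i → Forward w i ⊎ Backward w i
        orientation i with ∈-∃++ (∈w (bodyEdge∈E i))
        ... | p , q , refl
          with chain-one-side i p (chain-prefix p q chain) (off-body i ∈-++⁺ˡ (proj₁ (unique-∉-split p unique-w)))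
             | chain-one-side i q (chain-suffix p q chain) (off-body i (∈-++⁺ʳ p ∘ there) (proj₂ (unique-∉-split p unique-w)))
        ... | inj₁ below-p | inj₂ above-q = inj₁ (p , q , refl , below-p , above-q)
        ... | inj₂ above-p | inj₁ below-q = inj₂ (p , q , refl , above-p , below-q)
        ... | inj₁ below-p | inj₁ below-q = ⊥-elim (all-below (locate refl (∈w last∈)))
          where
          all-below : last ∈ p ⊎ last ≡ bodyEdge i ⊎ last ∈ q → ⊥
          all-below (inj₁ last∈p) = below-above {i} (All.lookup below-p last∈p) (last-above i)
          all-below (inj₂ (inj₁ refl)) = bodyEdge-¬above (last-above i)
          all-below (inj₂ (inj₂ last∈q)) = below-above {i} (All.lookup below-q last∈q) (last-above i)
        ... | inj₂ above-p | inj₂ above-q = ⊥-elim (all-above (locate refl (∈w first∈)))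
          where
          all-above : first ∈ p ⊎ first ≡ bodyEdge i ⊎ first ∈ q → ⊥
          all-above (inj₁ first∈p) = below-above {i} (first-below i) (All.lookup above-p first∈p)
          all-above (inj₂ (inj₁ refl)) = bodyEdge-¬below (first-below i)
          all-above (inj₂ (inj₂ first∈q)) = below-above {i} (first-below i) (All.lookup above-q first∈q)

        forward-below : ∀ {i x} → Forward w i → x ∈ w → Below i x → Before w x (bodyEdge i)
        forward-below {i} (p , q , eq , below-p , above-q) x∈ below with locate eq x∈
        ... | inj₁ x∈p = before-split⁺ˡ eq x∈p
        ... | inj₂ (inj₁ refl) = ⊥-elim (bodyEdge-¬below below)
        ... | inj₂ (inj₂ x∈q) = ⊥-elim (below-above {i} below (All.lookup above-q x∈q))

        forward-above : ∀ {i x} → Forward w i → x ∈ w → Above i x → Before w (bodyEdge i) x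
        forward-above {i} (p , q , eq , below-p , above-q) x∈ above with locate eq x∈
        ... | inj₁ x∈p = ⊥-elim (below-above {i} (All.lookup below-p x∈p) above)
        ... | inj₂ (inj₁ refl) = ⊥-elim (bodyEdge-¬above above)
        ... | inj₂ (inj₂ x∈q) = before-split⁺ʳ eq x∈q

        backward-below : ∀ {i x} → Backward w i → x ∈ w → Below i x → Before w (bodyEdge i) x
        backward-below {i} (p , q , eq , above-p , below-q) x∈ below with locate eq x∈
        ... | inj₁ x∈p = ⊥-elim (below-above {i} below (All.lookup above-p x∈p))
        ... | inj₂ (inj₁ refl) = ⊥-elim (bodyEdge-¬below below)
        ... | inj₂ (inj₂ x∈q) = before-split⁺ʳ eq x∈q

        forward-everywhere : ∀ i₀ → toℕ i₀ ≡ 0 → Forward w i₀ → ∀ i → Forward w i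
        forward-everywhere i₀ i₀≡0 fwd i with orientation i
        ... | inj₁ fwd-i = fwd-i
        ... | inj₂ bwd-i with toℕ i ℕ.≟ 0
        ...   | yes i≡0 with Fₚ.toℕ-injective (trans i≡0 (sym i₀≡0))
        ...     | refl = ⊥-elim (before-asym unique-w (forward-below fwd (∈w first∈) (first-below i₀))
                                                        (backward-below bwd-i (∈w first∈) (first-below i)))
        forward-everywhere i₀ i₀≡0 fwd i | inj₂ bwd-i | no i≢0 =
          ⊥-elim (before-asym unique-w (forward-above fwd (∈w (bodyEdge∈E i)) above-i₀)
                                       (backward-below bwd-i (∈w (bodyEdge∈E i₀)) below-i))
          where
          1≤2i : 1 ≤ 2 * toℕ i
          1≤2i = ℕₚ.≤-trans (ℕₚ.n≢0⇒n>0 i≢0) (ℕₚ.m≤m+n (toℕ i) _)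
          below-i : Below i (bodyEdge i₀)
          below-i = subst (_≤ 2 * toℕ i) (sym (trans (rank-bodyEdge i₀) (cong (λ t → suc (2 * t)) i₀≡0))) 1≤2i
          above-i₀ : Above i₀ (bodyEdge i)
          above-i₀ = subst₂ _≤_ (cong (λ t → suc (suc (2 * t))) (sym i₀≡0)) (sym (rank-bodyEdge i)) (s≤s 1≤2i)

        -- Any descent a … b with rank b < rank a would put b before and a after some body edge.
        forward⇒sorted : (∀ i → Forward w i) → Sorted rank w
        forward⇒sorted fwd = allPairs-split⁺ w λ p a q eq → All.tabulate λ b∈q → ordered (before-split⁺ʳ eq b∈q)
          where
          ordered : ∀ {a b} → Before w a b → rank a ≤ rank b
          ordered {a} {b} a<b with rank a ℕ.≤? rank b
          ... | yes ≤ = ≤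
          ... | no ≰ with edge-rank (∈E (before-∈ˡ a<b)) | edge-rank (∈E (before-∈ʳ a<b))
          ...   | inj₂ (ia , refl , rank-a) | _ =
            ⊥-elim (before-asym unique-w a<b (forward-below (fwd ia) (before-∈ʳ a<b) (ℕₚ.≤-pred (subst (rank b <_) rank-a (ℕₚ.≰⇒> ≰)))))
          ...   | inj₁ _ | inj₂ (ib , refl , rank-b) =
            ⊥-elim (before-asym unique-w a<b (forward-above (fwd ib) (before-∈ˡ a<b) (subst (_≤ rank a) (cong suc rank-b) (ℕₚ.≰⇒> ≰))))
          ...   | inj₁ (ja , _ , rank-a) | inj₁ (jb , _ , rank-b) =
            ⊥-elim (before-cycle₃ unique-w a<b (forward-below (fwd i) (before-∈ʳ a<b) b-below) (forward-above (fwd i) (before-∈ˡ a<b) a-above))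
            where
            jb<ja : toℕ jb < toℕ ja
            jb<ja = ℕₚ.*-cancelˡ-< 2 (toℕ jb) (toℕ ja) (subst₂ _<_ rank-b rank-a (ℕₚ.≰⇒> ≰))
            jb<k : toℕ jb < k
            jb<k = ℕₚ.<-≤-trans jb<ja (ℕₚ.≤-pred (Fₚ.toℕ<n ja))
            i = fromℕ< jb<k
            b-below : Below i b
            b-below = subst (λ t → rank b ≤ 2 * t) (sym (Fₚ.toℕ-fromℕ< jb<k)) (ℕₚ.≤-reflexive rank-b)
            a-above : Above i a
            a-above = subst (λ t → suc (suc (2 * t)) ≤ rank a) (sym (Fₚ.toℕ-fromℕ< jb<k))
                        (subst₂ _≤_ (ℕₚ.*-suc 2 (toℕ jb)) (sym rank-a) (ℕₚ.*-monoʳ-≤ 2 jb<ja))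

      chain⇒sorted : ∀ (i₀ : Fin k) → toℕ i₀ ≡ 0 → ∀ {w} → Chain w → w ↭ E → Sorted rank w ⊎ Sorted rank (reverse w)
      chain⇒sorted i₀ i₀≡0 {w} chain w↭ with orientation chain w↭ i₀
      ... | inj₁ fwd = inj₁ (forward⇒sorted chain w↭ (forward-everywhere chain w↭ i₀ i₀≡0 fwd))
      ... | inj₂ (p , q , eq , above-p , below-q) =
        inj₂ (forward⇒sorted chain′ w′↭ (forward-everywhere chain′ w′↭ i₀ i₀≡0
                (reverse q , reverse p , trans (cong reverse eq) (reverse-split p q _) , all-reverse q below-q , all-reverse p above-p)))
        where
        chain′ = chain-reverse w chain
        w′↭ = ↭-trans (↭.↭-reverse w) w↭

    NoBodyEdgeBetween : ℕ → ℕ → Set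
    NoBodyEdgeBetween r s = ∀ t → t < k → r < suc (2 * t) → suc (2 * t) < s → ⊥

    no-body-edge-between⇒share : ∀ {a b} → a ∈ E → b ∈ E → a ≢ b → rank a ≤ rank b →
      NoBodyEdgeBetween (rank a) (rank b) → Share a b
    no-body-edge-between⇒share {a} {b} a∈ b∈ a≢b a≤b no-body-between = by-kind (edge-rank a∈) (edge-rank b∈)
      where
      2t<2t+1 : ∀ t → 2 * t < suc (2 * t)
      2t<2t+1 t = ℕₚ.n<1+n _
      2s+1<2t : ∀ {s t} → s < t → suc (2 * s) < 2 * t
      2s+1<2t {s} {t} s<t = subst (_≤ 2 * t) (ℕₚ.*-suc 2 s) (ℕₚ.*-monoʳ-≤ 2 s<t)
      by-kind : (∃ λ j → LeafEdgeAt j a × rank a ≡ 2 * toℕ j) ⊎ (∃ λ i → a ≡ bodyEdge i × rank a ≡ suc (2 * toℕ i)) →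
                (∃ λ j → LeafEdgeAt j b × rank b ≡ 2 * toℕ j) ⊎ (∃ λ i → b ≡ bodyEdge i × rank b ≡ suc (2 * toℕ i)) → Share a b
      by-kind (inj₁ (ja , (_ , _ , joins-a) , ra)) (inj₁ (jb , (_ , _ , joins-b) , rb)) with toℕ ja ℕ.≟ toℕ jb
      ... | yes same with Fₚ.toℕ-injective same
      ...   | refl = v ja , joins-incidentʳ joins-a , joins-incidentʳ joins-b
      by-kind (inj₁ (ja , _ , ra)) (inj₁ (jb , _ , rb)) | no differ =
        ⊥-elim (no-body-between (toℕ ja) (ℕₚ.<-≤-trans ja<jb (ℕₚ.≤-pred (Fₚ.toℕ<n jb)))
                  (subst (_< suc (2 * toℕ ja)) (sym ra) (2t<2t+1 (toℕ ja))) (subst (_ <_) (sym rb) (2s+1<2t ja<jb)))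
        where
        ja<jb = ℕₚ.≤∧≢⇒< (ℕₚ.*-cancelˡ-≤ 2 (subst₂ _≤_ ra rb a≤b)) differ
      by-kind (inj₁ (ja , (_ , _ , joins-a) , ra)) (inj₂ (ib , refl , rb)) with toℕ ja ℕ.≟ toℕ ib
      ... | yes same with Fₚ.toℕ-injective (trans same (sym (Fₚ.toℕ-inject₁ ib)))
      ...   | refl = v ja , joins-incidentʳ joins-a , joins-incidentˡ (bodyEdge-isBodyEdge ib)
      by-kind (inj₁ (ja , _ , ra)) (inj₂ (ib , refl , rb)) | no differ =
        ⊥-elim (no-body-between (toℕ ja) (ℕₚ.<-trans ja<ib (Fₚ.toℕ<n ib))
                  (subst (_< suc (2 * toℕ ja)) (sym ra) (2t<2t+1 (toℕ ja))) (subst (_ <_) (sym rb) (s≤s (ℕₚ.<⇒≤ (2s+1<2t ja<ib)))))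
        where
        ja<ib = ℕₚ.≤∧≢⇒< (2m≤1+2n⇒m≤n (subst₂ _≤_ ra rb a≤b)) differ
      by-kind (inj₂ (ia , refl , ra)) (inj₁ (jb , (_ , _ , joins-b) , rb)) with suc (toℕ ia) ℕ.≟ toℕ jb
      ... | yes same with Fₚ.toℕ-injective same
      ...   | refl = v (suc ia) , joins-incidentʳ (bodyEdge-isBodyEdge ia) , joins-incidentʳ joins-b
      by-kind (inj₂ (ia , refl , ra)) (inj₁ (jb , _ , rb)) | no differ =
        ⊥-elim (no-body-between (suc (toℕ ia)) (ℕₚ.<-≤-trans ia+1<jb (ℕₚ.≤-pred (Fₚ.toℕ<n jb)))
                  (subst (_< _) (sym ra) (s≤s (subst (2 * toℕ ia <_) (sym (ℕₚ.*-suc 2 (toℕ ia))) (ℕₚ.≤-trans (ℕₚ.n<1+n _) (ℕₚ.n≤1+n _)))))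
                  (subst (_ <_) (sym rb) (2s+1<2t ia+1<jb)))
        where
        ia<jb : suc (toℕ ia) ≤ toℕ jb
        ia<jb = ℕₚ.*-cancelˡ-≤ 2 (subst (_≤ 2 * toℕ jb) (sym (ℕₚ.*-suc 2 (toℕ ia)))
                  (ℕₚ.≤∧≢⇒< (subst₂ _≤_ ra rb a≤b) (λ odd≡even → ℕₚ.even≢odd (toℕ jb) (toℕ ia) (sym odd≡even))))
        ia+1<jb = ℕₚ.≤∧≢⇒< ia<jb differ
      by-kind (inj₂ (ia , refl , ra)) (inj₂ (ib , refl , rb)) with toℕ ia ℕ.≟ toℕ ib
      ... | yes same = ⊥-elim (a≢b (cong bodyEdge (Fₚ.toℕ-injective same)))
      ... | no differ with suc (toℕ ia) ℕ.≟ toℕ ib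
      ...   | yes next = v (inject₁ ib) ,
        subst (λ t → Incident (v t) a) (Fₚ.toℕ-injective (trans next (sym (Fₚ.toℕ-inject₁ ib)))) (joins-incidentʳ (bodyEdge-isBodyEdge ia)) ,
        joins-incidentˡ (bodyEdge-isBodyEdge ib)
      by-kind (inj₂ (ia , refl , ra)) (inj₂ (ib , refl , rb)) | no differ | no not-next =
        ⊥-elim (no-body-between (suc (toℕ ia)) (ℕₚ.<-trans ia+1<ib (Fₚ.toℕ<n ib))
                  (subst (_< _) (sym ra) (s≤s (subst (2 * toℕ ia <_) (sym (ℕₚ.*-suc 2 (toℕ ia))) (ℕₚ.≤-trans (ℕₚ.n<1+n _) (ℕₚ.n≤1+n _)))))
                  (subst (_ <_) (sym rb) (s≤s (ℕₚ.<⇒≤ (2s+1<2t ia+1<ib)))))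
        where
        ia<ib = ℕₚ.≤∧≢⇒< (ℕₚ.*-cancelˡ-≤ 2 (ℕₚ.≤-pred (subst₂ _≤_ ra rb a≤b))) differ
        ia+1<ib = ℕₚ.≤∧≢⇒< ia<ib not-next

    sorted⇒chain : ∀ w → w ↭ E → Sorted rank w → Chain w
    sorted⇒chain w w↭ sorted = chain-split⁺ w shares
      where
      unique-w : Unique w
      unique-w = unique-resp-↭ unique-E (↭-sym w↭)
      no-rank-between : ∀ {p a b q c} → w ≡ p ++ a ∷ b ∷ q → c ∈ E → rank a < rank c → rank c < rank b → ⊥
      no-rank-between {p} {a} {b} {q} eq c∈ a<c c<b with locate eq (↭.∈-resp-↭ (↭-sym w↭) c∈)
      ... | inj₁ c∈p = ℕₚ.<-irrefl refl (ℕₚ.<-≤-trans a<c (All.lookup (proj₁ (allPairs-split⁻ p (subst (Sorted rank) eq sorted))) c∈p))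
      ... | inj₂ (inj₁ refl) = ℕₚ.<-irrefl refl a<c
      ... | inj₂ (inj₂ (here refl)) = ℕₚ.<-irrefl refl c<b
      ... | inj₂ (inj₂ (there c∈q)) =
        ℕₚ.<-irrefl refl (ℕₚ.<-≤-trans c<b (All.lookup (proj₂ (allPairs-split⁻ (p ++ [ a ]) (subst (Sorted rank) eq′ sorted))) c∈q))
        where
        eq′ : w ≡ (p ++ [ a ]) ++ b ∷ q
        eq′ = trans eq (sym (++-assoc p [ a ] (b ∷ q)))
      no-body-between : ∀ {p a b q} → w ≡ p ++ a ∷ b ∷ q → NoBodyEdgeBetween (rank a) (rank b)
      no-body-between eq t t<k a< <b =
        no-rank-between eq (bodyEdge∈E (fromℕ< t<k)) (subst (_ <_) (sym rank-t) a<) (subst (_< _) (sym rank-t) <b)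
        where
        rank-t = trans (rank-bodyEdge (fromℕ< t<k)) (cong (λ s → suc (2 * s)) (Fₚ.toℕ-fromℕ< t<k))
      shares : ∀ p a b q → w ≡ p ++ a ∷ b ∷ q → Share a b
      shares p a b q eq =
        no-body-edge-between⇒share (∈E (∈-++⁺ʳ p (here refl))) (∈E (∈-++⁺ʳ p (there (here refl)))) a≢b a≤b (no-body-between eq)
        where
        ∈E : ∀ {g} → g ∈ p ++ a ∷ b ∷ q → g ∈ E
        ∈E = ↭.∈-resp-↭ w↭ ∘ subst (_ ∈_) (sym eq)
        a≤b : rank a ≤ rank b
        a≤b with proj₂ (allPairs-split⁻ p (subst (Sorted rank) eq sorted))
        ... | a≤b ∷ _ = a≤b
        a≢b : a ≢ b
        a≢b a≡b = proj₂ (unique-∉-split p (subst Unique eq unique-w)) (here a≡b)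

module Counting {n k} (E : Edges n) (v : Fin (suc k) → Fin n) (C : IsCaterpillarWithBody E v) where

  open import Data.Nat using (ℕ; zero; suc; _+_; _*_; _≤_; _<_; z≤n; s≤s; _!)
  import Data.Nat.Properties as ℕₚ
  open import Data.Nat.ListAction using (product)
  open import Data.Fin using (Fin; zero; toℕ)
  import Data.Fin.Properties as Fₚ
  open import Data.List using (List; _++_; length; reverse; map; filter; allFin)
  open import Data.List.Properties using (reverse-involutive; reverse-injective; length-++; length-map; map-cong; filter-all)
  open import Data.List.Membership.Propositional using (_∈_)
  open import Data.List.Membership.Propositional.Properties using (∈-filter⁺; ∈-filter⁻; ∈-++⁺ˡ; ∈-++⁺ʳ; ∈-++⁻; ∈-map⁺; ∈-map⁻)
  open import Data.List.Relation.Unary.Any using (here; there)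
  import Data.List.Relation.Unary.All as All
  open import Data.List.Relation.Unary.Unique.Propositional using (Unique)
  import Data.List.Relation.Unary.Unique.Propositional.Properties as Unique
  open import Data.List.Relation.Binary.Permutation.Propositional using (_↭_; ↭-sym; ↭-trans)
  import Data.List.Relation.Binary.Permutation.Propositional.Properties as ↭
  open import Data.Product using (_×_; _,_; proj₁; proj₂; ∃)
  open import Data.Sum using (inj₁; inj₂)
  open import Data.Empty using (⊥; ⊥-elim)
  open import Function using (_∘_)
  open import Relation.Binary.PropositionalEquality using (_≡_; _≢_; refl; sym; trans; cong; subst; subst₂; module ≡-Reasoning)
  open import Defs
  open ListFacts
  open Orderings
  open Transpositions
  open Chains
  open BlockOrderings
  open CaterpillarEdges
  open Separation
  open LeafBlocks
  open CaterpillarChains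

  open Caterpillar E v C

  layout : KeyLayout rank 0 k (leafEdges E v C) bodyEdge
  layout = keyLayout rank 0 k (leafEdges E v C) bodyEdge
    (λ j g∈ → rank-leafEdge (proj₂ (∈-leafEdges⁻ E v C g∈))) rank-bodyEdge

  blocks : Edges n
  blocks = concatBlocks rank k (leafEdges E v C) bodyEdge

  sorted-orderings : List (Edges n)
  sorted-orderings = blockOrderings rank k (leafEdges E v C) bodyEdge

  unique-blocks : Unique blocks
  unique-blocks = unique-concatBlocks rank 0 k (leafEdges E v C) bodyEdge layout (unique-leafEdges E v C)

  blocks↭E : blocks ↭ E
  blocks↭E = unique-sameElements⇒↭ unique-blocks unique-E in-E in-blocks
    where
    in-E : ∀ {g} → g ∈ blocks → g ∈ E
    in-E g∈ with ∈-concatBlocks⁻ rank k (leafEdges E v C) bodyEdge g∈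
    ... | inj₁ (j , g∈L) = proj₁ (∈-leafEdges⁻ E v C g∈L)
    ... | inj₂ (i , refl) = bodyEdge∈E i
    in-blocks : ∀ {g} → g ∈ E → g ∈ blocks
    in-blocks g∈ with edge-kind g∈
    ... | inj₁ (j , leafEdge) = ∈-concatBlocks⁺ˡ rank k (leafEdges E v C) bodyEdge j (∈-leafEdges⁺ E v C g∈ leafEdge)
    ... | inj₂ (i , refl) = ∈-concatBlocks⁺ʳ rank k (leafEdges E v C) bodyEdge i

  sorted⇒∈-sorted-orderings : ∀ {w} → w ↭ E × Sorted rank w → w ∈ sorted-orderings
  sorted⇒∈-sorted-orderings (w↭ , sorted) =
    sorted⇒∈-blockOrderings rank 0 k (leafEdges E v C) bodyEdge layout (↭-trans w↭ (↭-sym blocks↭E)) sorted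

  ∈-sorted-orderings⇒sorted : ∀ {w} → w ∈ sorted-orderings → w ↭ E × Sorted rank w
  ∈-sorted-orderings⇒sorted w∈ =
    ↭-trans (blockOrderings-↭ rank k (leafEdges E v C) bodyEdge w∈) blocks↭E ,
    blockOrderings-sorted rank 0 k (leafEdges E v C) bodyEdge layout w∈

  #chains : numMultOne E ≡ length (filter chain? (orderings E))
  #chains = numMultOne≡#chains E unique-E (product-determines-order E v C)

  private
    ∈-chains⁻ : ∀ {w} → w ∈ filter chain? (orderings E) → w ↭ E × Chain w
    ∈-chains⁻ w∈ with ∈-filter⁻ chain? {xs = orderings E} w∈
    ... | w∈o , chain = orderings-↭ E w∈o , chain

    ∈-chains⁺ : ∀ {w} → w ↭ E → Chain w → w ∈ filter chain? (orderings E)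
    ∈-chains⁺ w↭ chain = ∈-filter⁺ chain? (↭⇒∈-orderings E w↭) chain

  -- Without body edges every edge is at v 0, so every ordering is a chain.
  star-count : k ≡ 0 → numMultOne E ≡ leavesAt E (v zero) !
  star-count k≡0 = begin
    numMultOne E                            ≡⟨ #chains ⟩
    length (filter chain? (orderings E))    ≡⟨ cong length (filter-all chain? (All.tabulate (all-chains ∘ orderings-↭ E))) ⟩
    length (orderings E)                    ≡⟨ length-orderings E ⟩
    length E !                              ≡⟨ cong _! (trans (↭.↭-length E↭L₀) (length-leafEdges E v C zero)) ⟩
    leavesAt E (v zero) !                   ∎
    where
    open ≡-Reasoning
    at-zero : ∀ {g} → g ∈ E → LeafEdgeAt zero g
    at-zero g∈ with edge-kind g∈
    ... | inj₂ (i , _) = ⊥-elim (Fₚ.¬Fin0 (subst Fin k≡0 i))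
    ... | inj₁ (j , leafEdge) =
      subst (λ j → LeafEdgeAt j _) (Fₚ.toℕ-injective (ℕₚ.n≤0⇒n≡0 (ℕₚ.≤-pred (subst (toℕ j <_) (cong suc k≡0) (Fₚ.toℕ<n j)))))
        leafEdge
    all-chains : ∀ {w} → w ↭ E → Chain w
    all-chains {w} w↭ = chain-split⁺ w λ p a b q eq →
      v zero , at-v0 (↭.∈-resp-↭ w↭ (subst (a ∈_) (sym eq) (∈-++⁺ʳ p (here refl))))
             , at-v0 (↭.∈-resp-↭ w↭ (subst (b ∈_) (sym eq) (∈-++⁺ʳ p (there (here refl)))))
      where
      at-v0 : ∀ {g} → g ∈ E → Incident (v zero) g
      at-v0 g∈ = joins-incidentʳ (proj₂ (proj₂ (at-zero g∈)))
    E↭L₀ : E ↭ leafEdges E v C zero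
    E↭L₀ = unique-sameElements⇒↭ unique-E (unique-leafEdges E v C zero)
             (λ g∈ → ∈-leafEdges⁺ E v C g∈ (at-zero g∈)) (proj₁ ∘ ∈-leafEdges⁻ E v C)

  module _ (i₀ iₖ : Fin k) (i₀≡0 : toℕ i₀ ≡ 0) (iₖ+1≡k : suc (toℕ iₖ) ≡ k) where

    private
      first : ∃ λ g → g ∈ E × rank g ≡ 0
      first = first-leafEdge E v C i₀ i₀≡0

      last : ∃ λ g → g ∈ E × rank g ≡ 2 * k
      last = last-leafEdge E v C iₖ iₖ+1≡k

    chain⇒sorted-either-way : ∀ {w} → w ∈ filter chain? (orderings E) → w ∈ sorted-orderings ++ map reverse sorted-orderings
    chain⇒sorted-either-way {w} w∈ with ∈-chains⁻ w∈
    ... | w↭ , chain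
      with chain⇒sorted E v C (proj₁ (proj₂ first)) (proj₂ (proj₂ first)) (proj₁ (proj₂ last)) (proj₂ (proj₂ last))
                          i₀ i₀≡0 {w} chain w↭
    ...   | inj₁ sorted = ∈-++⁺ˡ (sorted⇒∈-sorted-orderings (w↭ , sorted))
    ...   | inj₂ sorted = ∈-++⁺ʳ sorted-orderings (subst (_∈ map reverse sorted-orderings) (reverse-involutive w)
                            (∈-map⁺ reverse (sorted⇒∈-sorted-orderings (↭-trans (↭.↭-reverse w) w↭ , sorted))))

    sorted-either-way⇒chain : ∀ {w} → w ∈ sorted-orderings ++ map reverse sorted-orderings → w ∈ filter chain? (orderings E)
    sorted-either-way⇒chain {w} w∈ with ∈-++⁻ sorted-orderings w∈
    ... | inj₁ w∈s = let (w↭ , sorted) = ∈-sorted-orderings⇒sorted w∈s in ∈-chains⁺ w↭ (sorted⇒chain E v C w w↭ sorted)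
    ... | inj₂ w∈r with ∈-map⁻ reverse w∈r
    ...   | u , u∈ , refl = let (u↭ , sorted) = ∈-sorted-orderings⇒sorted u∈ in
      ∈-chains⁺ (↭-trans (↭.↭-reverse u) u↭) (chain-reverse u (sorted⇒chain E v C u u↭ sorted))

    -- An ordering sorted both ways would have the leaf edges of rank 0 and 2 k in both orders.
    unique-sorted-either-way : Unique (sorted-orderings ++ map reverse sorted-orderings)
    unique-sorted-either-way = Unique.++⁺ unique-sorted (Unique.map⁺ reverse-injective unique-sorted) (λ (a , b) → not-both a b)
      where
      unique-sorted : Unique sorted-orderings
      unique-sorted = unique-blockOrderings rank k (leafEdges E v C) bodyEdge unique-blocks
      2k>0 : 0 < 2 * k
      2k>0 = ℕₚ.*-monoʳ-< 2 (subst (0 <_) iₖ+1≡k (s≤s z≤n))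
      not-both : ∀ {w} → w ∈ sorted-orderings → w ∈ map reverse sorted-orderings → ⊥
      not-both w∈ w∈r with ∈-map⁻ reverse w∈r
      ... | u , u∈ , refl = ℕₚ.<-irrefl refl (ℕₚ.<-≤-trans 2k>0 (subst₂ _≤_ (proj₂ (proj₂ last)) (proj₂ (proj₂ first)) (proj₂ both)))
        where
        in-reverse-u : ∀ {g} → g ∈ E → g ∈ reverse u
        in-reverse-u = ↭.∈-resp-↭ (↭-sym (proj₁ (∈-sorted-orderings⇒sorted w∈)))
        first≢last : proj₁ first ≢ proj₁ last
        first≢last eq = ℕₚ.<-irrefl refl (ℕₚ.<-≤-trans 2k>0
                          (ℕₚ.≤-reflexive (trans (sym (proj₂ (proj₂ last))) (trans (cong rank (sym eq)) (proj₂ (proj₂ first))))))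
        both = allPairs-both-ways (reverse u) (proj₂ (∈-sorted-orderings⇒sorted w∈))
                 (subst (Sorted rank) (sym (reverse-involutive u)) (proj₂ (∈-sorted-orderings⇒sorted u∈)))
                 (in-reverse-u (proj₁ (proj₂ first))) (in-reverse-u (proj₁ (proj₂ last))) first≢last

    caterpillar-count : numMultOne E ≡ 2 * prodFact (λ j → leavesAt E (v j))
    caterpillar-count = begin
      numMultOne E                                                    ≡⟨ #chains ⟩
      length (filter chain? (orderings E))
        ≡⟨ unique-sameElements⇒length≡ (Unique.filter⁺ chain? (unique-orderings E unique-E)) unique-sorted-either-way
                                       chain⇒sorted-either-way sorted-either-way⇒chain ⟩
      length (sorted-orderings ++ map reverse sorted-orderings)       ≡⟨ length-++ sorted-orderings ⟩
      length sorted-orderings + length (map reverse sorted-orderings)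
        ≡⟨ cong (length sorted-orderings +_) (trans (length-map reverse sorted-orderings) (sym (ℕₚ.+-identityʳ _))) ⟩
      2 * length sorted-orderings                                     ≡⟨ cong (2 *_) (length-blockOrderings rank k (leafEdges E v C) bodyEdge) ⟩
      2 * product (map (λ j → length (leafEdges E v C j) !) (allFin (suc k)))
        ≡⟨ cong (λ l → 2 * product l) (map-cong (λ j → cong _! (length-leafEdges E v C j)) (allFin (suc k))) ⟩
      2 * prodFact (λ j → leavesAt E (v j))                           ∎
      where open ≡-Reasoning

corollary3p3 : (n k : ℕ) (E : Edges n) (v : Fin (suc k) → Fin n) →
    IsCaterpillarWithBody E v →
      (k ≥ 1 → numMultOne E ≡ 2 * prodFact (λ i → leavesAt E (v i)))
      × (k ≡ 0 → numMultOne E ≡ leavesAt E (v zero) !)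
corollary3p3 n zero E v C = (λ ()) , Counting.star-count E v C
corollary3p3 n (suc k) E v C =
  (λ _ → Counting.caterpillar-count E v C zero (fromℕ k) refl (cong suc (toℕ-fromℕ k))) , (λ ())
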